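{- For integers $i,j,k\ge0$ the following Sprague–Grundy values hold for \textsc{flag coloring} on the (properly two-colored) graphs described in the context. (A) $P_{0^{1+}2^i4^j6^k}$ with $k=1$: value $\ast1$ if $i$ is even; if $i$ is odd: $\ast2$ if $j=0$, $0$ if $j$ is odd, $\ast3$ if $j\ge2$ is even. (B) $P_{0^{1+}2^i4^j6^k}$ with $k=2$: if $i$ is even: $\ast2$ for $j$ even, $0$ for $j$ odd; if $i$ is odd: $\ast1$ for $j$ even, $\ast4$ for $j$ odd. (C) $P_{0^{1+}2^i4^j6^k}$ with $k\ge3$: if $i$ is even: $\ast1$ for $j$ even, $0$ for $j$ odd; if $i$ is odd: $\ast2$ for $j$ even, $\ast3$ for $j$ odd. (D) $P_{1^{1+}3^i5^j}$: $\ast1$ if $i$ is even, $0$ if $i$ is odd. (E) $P_{2^i4^j}$ (no length-6 paths, $u\ne v$): if $i=0$: $\ast1$ for $j=1$, $0$ otherwise; if $i=1$: $\ast2$ for $j$ even, $\ast1$ for $j$ odd; if $i\ge2$ is even: $0$ for $j$ even, $\ast1$ for $j$ odd; if $i\ge3$ is odd: $0$ for $j=0$, $\ast1$ for $j$ odd, $\ast2$ for $j\ge2$ even. (F) $P_{2^i4^j6^1}$: if $i=0$: $0$ for $j=0$, $\ast1$ for $j\ge1$; if $i$ is odd: $0$ for $j$ even, $\ast3$ for $j$ odd; if $i\ge2$ is even: $0$ for $j$ even, $\ast1$ for $j$ odd. (G) $P_{2^i4^j6^2}$: if $i=0$: $0$ for $j$ even, $\ast2$ for $j$ odd; if $i\ge1$: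 $0$ for $j$ even, $\ast1$ for $j$ odd. (H) $P_{2^i4^j6^k}$ with $k\ge3$: $0$ for $j$ even, $\ast1$ for $j$ odd. (I) $P_{3^i5^j}$ ($u,v$ non-adjacent): if $i=0$: $0$ for $j=0$, $\ast2$ for $j=1$, $\ast1$ for $j\ge2$; if $i=1$: $0$; if $i\ge2$ is even: $\ast1$ for $j$ even, $\ast3$ for $j=1$, $\ast2$ for $j\ge3$ odd; if $i\ge3$ is odd: $\ast2$ for $j=0$, $0$ for $j\ge1$.
   Context: \textsc{flag coloring} is an impartial two-player game played on a simple graph whose vertices are colored. A move consists of choosing a vertex $v$, of color $c$ say, and a color $c'\neq c$ that is the color of some vertex adjacent to $v$; then $v$ and every vertex of the connected component of the subgraph induced by color-$c$ vertices that contains $v$ are recolored $c'$. Play is under the normal play convention: a player unable to move loses. Each position gets a Sprague–Grundy value (nimber) $\ast n$, where $n$ is the minimum non-negative integer not among the values of its options (positions with no options have value $0$). Notation: all graphs below consist of two vertices $u,v$ joined by internally vertex-disjoint paths, properly two-colored, all path lengths having the same parity. $P_{2^i4^j6^k}$ denotes distinct vertices $u\neq v$ joined by $i$ paths of length $2$, $j$ paths of length $4$ and $k$ paths of length $6$ (and nothing else). $P_{0^{1+}2^i4^j6^k}$ denotes the graph in which $u=v$ (a single vertex) together with $i$ paths of length 2, $j$ paths of length 4 and $k$ paths of length 6 from this vertex to itself; i.e. $i$ pendant vertices, $j$ cycles of length 4 and $k$ cycles of length 6, all sharing only that vertex. $P_{3^i5^j}$ denotes distinct non-adjacent $u,v$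 joined by $i$ paths of length 3 and $j$ paths of length 5. $P_{1^{1+}3^i5^j}$ denotes the same graph with additionally the edge $uv$. -}

module Defs where

open import Data.Nat using (ℕ; zero; suc; _<_)
open import Data.Bool using (Bool; true; false; if_then_else_)
open import Data.Unit using (⊤; tt)
open import Data.Fin using (Fin)
open import Data.List using (List; []; _∷_; length; lookup; replicate; _++_)
open import Data.Product using (Σ; _×_; _,_)
open import Data.Sum using (_⊎_; inj₁; inj₂)
open import Relation.Nullary using (¬_)
open import Relation.Binary.PropositionalEquality using (_≡_; _≢_)

record Graph : Set₁ where
  field
    V   : Set
    Adj : V → V → Set

module _ (G : Graph) where
  open Graph G

  data Reach (col : V → ℕ) (c : ℕ) (v : V) : V → Set where
    here : col v ≡ c → Reach col c v v
    step : ∀ {w x} → Reach col c v w → Adj w x → col x ≡ c → Reach col c v x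

  -- Move p q : q is obtained from p by one legal move: pick a vertex v and a
  -- neighbour w of v with a different colour c' = p w, and recolour the
  -- monochromatic component of v (of colour p v) with c'.
  Move : (V → ℕ) → (V → ℕ) → Set
  Move p q = Σ V λ v → Σ V λ w → Adj v w × (p w ≢ p v)
           × ((∀ x → Reach p (p v) v x → q x ≡ p w)
           × (∀ x → ¬ Reach p (p v) v x → q x ≡ p x))

  -- Since the game is finite and
  -- well-founded this relation is functional.
  data SG : (V → ℕ) → ℕ → Set where
    sg : ∀ {p n}
       → (f : ∀ q → Move p q → ℕ)
       → (∀ q (mv : Move p q) → SG q (f q mv))
       → ¬ (Σ (V → ℕ) λ q → Σ (Move p q) λ mv → f q mv ≡ n)
       → (∀ m → m < n → Σ (V → ℕ) λ q → Σ (Move p q) λ mv → f q mv ≡ m)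
       → SG p n

  ProperTwoColouring : (V → ℕ) → Set
  ProperTwoColouring col =
    Σ ℕ λ a → Σ ℕ λ b → (∀ x → col x ≡ a ⊎ col x ≡ b)
      × (∀ x y → Adj x y → col x ≢ col y)

  HasValue : ℕ → Set
  HasValue n = ∀ col → ProperTwoColouring col → SG col n

-- Theta-like graphs: endpoints u, v (identified when sep = false), joined
-- by internally disjoint paths whose lengths are listed in ls.

Endpt : Bool → Set
Endpt true  = Bool
Endpt false = ⊤

uE : (s : Bool) → Endpt s
uE true  = false
uE false = tt

vE : (s : Bool) → Endpt s
vE true  = true
vE false = tt

Mid : List ℕ → Set
Mid ls = Σ (Fin (length ls)) λ p → Σ ℕ λ t → (0 < t) × (t < lookup ls p)

Vtx : Bool → List ℕ → Set
Vtx s ls = Endpt s ⊎ Mid ls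

data At (s : Bool) (ls : List ℕ) (p : Fin (length ls)) : ℕ → Vtx s ls → Set where
  atU : At s ls p 0 (inj₁ (uE s))
  atV : At s ls p (lookup ls p) (inj₁ (vE s))
  atM : ∀ t (h₁ : 0 < t) (h₂ : t < lookup ls p) → At s ls p t (inj₂ (p , t , h₁ , h₂))

ThetaAdj : (s : Bool) (ls : List ℕ) → Vtx s ls → Vtx s ls → Set
ThetaAdj s ls x y = Σ (Fin (length ls)) λ p → Σ ℕ λ t →
  (At s ls p t x × At s ls p (suc t) y) ⊎ (At s ls p t y × At s ls p (suc t) x)

Theta : Bool → List ℕ → Graph
Theta s ls = record { V = Vtx s ls ; Adj = ThetaAdj s ls }

L246 : ℕ → ℕ → ℕ → List ℕ
L246 i j k = replicate i 2 ++ replicate j 4 ++ replicate k 6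

L35 : ℕ → ℕ → List ℕ
L35 i j = replicate i 3 ++ replicate j 5

-- P_{0^{1+} 2^i 4^j 6^k}  (u = v)
P0 : ℕ → ℕ → ℕ → Graph
P0 i j k = Theta false (L246 i j k)

P246 : ℕ → ℕ → ℕ → Graph
P246 i j k = Theta true (L246 i j k)

-- P_{1^{1+} 3^i 5^j}  (u ≠ v, plus the edge uv)
P1 : ℕ → ℕ → Graph
P1 i j = Theta true (1 ∷ L35 i j)

P35 : ℕ → ℕ → Graph
P35 i j = Theta true (L35 i j)

isEven : ℕ → Bool
isEven zero          = true
isEven (suc zero)    = false
isEven (suc (suc n)) = isEven n

valA : ℕ → ℕ → ℕ
valA i j with isEven i | j
... | true  | _     = 1
... | false | zero  = 2
... | false | suc _ = if isEven j then 3 else 0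

valB : ℕ → ℕ → ℕ
valB i j with isEven i | isEven j
... | true  | true  = 2
... | true  | false = 0
... | false | true  = 1
... | false | false = 4

valC : ℕ → ℕ → ℕ
valC i j with isEven i | isEven j
... | true  | true  = 1
... | true  | false = 0
... | false | true  = 2
... | false | false = 3

valD : ℕ → ℕ
valD i = if isEven i then 1 else 0

valE : ℕ → ℕ → ℕ
valE zero       (suc zero) = 1
valE zero       _          = 0
valE (suc zero) j          = if isEven j then 2 else 1
valE (suc (suc i')) j with isEven i' | j
... | true  | _     = if isEven j then 0 else 1
... | false | zero  = 0
... | false | suc _ = if isEven j then 2 else 1

valF : ℕ → ℕ → ℕ
valF zero zero    = 0
valF zero (suc _) = 1
valF (suc i') j with isEven i'
... | true  = if isEven j then 0 else 3
... | false = if isEven j then 0 else 1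

valG : ℕ → ℕ → ℕ
valG zero    j = if isEven j then 0 else 2
valG (suc _) j = if isEven j then 0 else 1

valH : ℕ → ℕ
valH j = if isEven j then 0 else 1

valI : ℕ → ℕ → ℕ
valI zero zero             = 0
valI zero (suc zero)       = 2
valI zero (suc (suc _))    = 1
valI (suc zero) _          = 0
valI (suc (suc i')) j with isEven i' | j
... | true  | zero     = 1
... | true  | suc zero = 3
... | true  | suc (suc _) = if isEven j then 1 else 2
... | false | zero     = 2
... | false | suc _    = 0

{-# OPTIONS --safe #-}
-- Only the colour changes along each u–v path matter.  With c_r the number of paths showing
-- r changes, a move either recolours a monochromatic run strictly inside one path, lowering
-- its count by 2, or recolours the component of an endpoint, lowering every count by 1
-- (u and v in different components) or by 2 (u and v in one component, whose monochromatic
-- paths then vanish).  So every two-coloured theta graph with paths of length at most 6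
-- collapses onto an abstract game on count triples.  On that game the claimed values
-- satisfy the mex recursion; counts beyond 3 matter only through their parity, so this is
-- checked by evaluation on counts up to 5.  A proper colouring of a path of length L shows
-- exactly L changes, which yields the stated graphs.

module Submission where

open import Defs
open import Data.Nat using (ℕ; zero; suc; _+_; _*_; _∸_; _≤_; _<_; _≥_; z≤n; s≤s; _≡ᵇ_; _≤ᵇ_; _<ᵇ_; _≟_; _≤?_; _<?_)
open import Data.Nat.Properties
open import Data.Nat.Tactic.RingSolver using (solve-∀)
open import Data.Bool using (Bool; true; false; not; _∧_; _∨_; _xor_; if_then_else_; T)
open import Data.Bool.Properties using (not-injective; not-¬; not-distribˡ-xor; not-distribʳ-xor; xor-same; ∨-zeroʳ)
open import Data.Maybe.Properties using (just-injective)
open import Data.List using (List; []; _∷_; length; lookup; replicate; _++_)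
open import Data.Vec using (Vec; []; _∷_)
open import Data.Fin using (Fin; zero; suc)
open import Data.List.Relation.Unary.All as All using (All; _∷_)
open import Data.List.Relation.Unary.All.Properties using (++⁺; replicate⁺)
open import Data.List.Membership.Propositional.Properties using (∈-lookup)
import Data.Fin.Properties as Fin
open import Data.Maybe using (Maybe; just; nothing)
open import Data.Product using (Σ; _×_; _,_; proj₁; proj₂)
open import Data.Sum using (_⊎_; inj₁; inj₂)
open import Relation.Binary.PropositionalEquality
open import Relation.Nullary using (¬_; Dec; yes; no)
open import Data.Unit using (⊤; tt)
open import Data.Empty using (⊥; ⊥-elim)

module BoolLemmas where


  T-∧-fst : ∀ {x y} → T (x ∧ y) → T x
  T-∧-fst {true} _ = tt

  T-∧-snd : ∀ {x y} → T (x ∧ y) → T y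
  T-∧-snd {true} p = p

  T-∧-fst′ : ∀ x y → T (x ∧ y) → T x
  T-∧-fst′ true _ _ = tt

  T-∧-snd′ : ∀ x y → T (x ∧ y) → T y
  T-∧-snd′ true _ p = p

  T-∧-intro : ∀ {x y} → T x → T y → T (x ∧ y)
  T-∧-intro {true} _ q = q

  T-∨-inl : ∀ {x y} → T x → T (x ∨ y)
  T-∨-inl {true} _ = tt

  T-∨-split : ∀ {x y} → T (x ∨ y) → T x ⊎ T y
  T-∨-split {true} p = inj₁ p
  T-∨-split {false} p = inj₂ p

  T-not : ∀ {x} → x ≡ false → T (not x)
  T-not refl = tt

  T⇒≡true : ∀ {x} → T x → x ≡ true
  T⇒≡true {true} _ = refl

  ≡true⇒T : ∀ {x} → x ≡ true → T x
  ≡true⇒T refl = tt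

  allBelow : ℕ → (ℕ → Bool) → Bool
  allBelow zero P = true
  allBelow (suc n) P = allBelow n P ∧ P n

  allBelow-sound : ∀ n P → T (allBelow n P) → ∀ m → m < n → T (P m)
  allBelow-sound (suc n) P p m m<n with m ≟ n
  ... | yes refl = T-∧-snd′ (allBelow n P) _ p
  ... | no m≢n = allBelow-sound n P (T-∧-fst′ (allBelow n P) _ p) m (≤∧≢⇒< (≤-pred m<n) m≢n)

  allBelow-intro : ∀ n P → (∀ m → m < n → T (P m)) → T (allBelow n P)
  allBelow-intro zero P h = tt
  allBelow-intro (suc n) P h = T-∧-intro (allBelow-intro n P (λ m lt → h m (<-trans lt (n<1+n _)))) (h n ≤-refl)

open BoolLemmas

module AbstractGame where

  val0-odd : Bool → ℕ → ℕ
  val0-odd true zero = 1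
  val0-odd true (suc zero) = 3
  val0-odd true (suc (suc j)) = if isEven j then 1 else 2
  val0-odd false zero = 2
  val0-odd false (suc _) = 0

  val0 : ℕ → ℕ → ℕ
  val0 zero j = 0
  val0 (suc i) j = val0-odd (isEven i) j

  -- merged i j k : u and v lie in one monochromatic component; i, j, k paths have 2, 4, 6 changes.
  -- sameEnds i j k : u and v are separate but equally coloured; same counts.
  -- diffEnds e i j : u and v have different colours; e, i, j paths have 1, 3, 5 changes.
  data Pos : Set where
    merged sameEnds diffEnds : ℕ → ℕ → ℕ → Pos

  value : Pos → ℕ
  value (merged i j zero) = val0 i j
  value (merged i j (suc zero)) = valA i j
  value (merged i j (suc (suc zero))) = valB i j
  value (merged i j (suc (suc (suc k)))) = valC i j
  value (sameEnds i j zero) = valE i j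
  value (sameEnds i j (suc zero)) = valF i j
  value (sameEnds i j (suc (suc zero))) = valG i j
  value (sameEnds i j (suc (suc (suc k)))) = valH j
  value (diffEnds zero i j) = valI i j
  value (diffEnds (suc e) i j) = valD i

  data MoveKind : Set where
    inner₂ inner₄ inner₆ flipEnd : MoveKind

  option : MoveKind → Pos → Maybe Pos
  option inner₂ (merged (suc i) j k) = just (merged i j k)
  option inner₄ (merged i (suc j) k) = just (merged (suc i) j k)
  option inner₆ (merged i j (suc k)) = just (merged i (suc j) k)
  option flipEnd (merged zero zero zero) = nothing
  option flipEnd (merged i j k) = just (merged j k 0)
  option inner₂ (sameEnds (suc i) j k) = just (merged i j k)
  option inner₄ (sameEnds i (suc j) k) = just (sameEnds (suc i) j k)
  option inner₆ (sameEnds i j (suc k)) = just (sameEnds i (suc j) k)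
  option flipEnd (sameEnds zero zero zero) = nothing
  option flipEnd (sameEnds i j k) = just (diffEnds i j k)
  option inner₄ (diffEnds e (suc i) j) = just (diffEnds (suc e) i j)
  option inner₆ (diffEnds e i (suc j)) = just (diffEnds e (suc i) j)
  option flipEnd (diffEnds (suc e) i j) = just (merged i j 0)
  option flipEnd (diffEnds zero zero zero) = nothing
  option flipEnd (diffEnds zero i j) = just (sameEnds i j 0)
  option _ _ = nothing

  data _≈_ : ℕ → ℕ → Set where
    ≈-exact : ∀ {a} → a ≈ a
    ≈-large : ∀ {a b} → isEven (suc a) ≡ isEven (suc b) → suc (suc (suc a)) ≈ suc (suc (suc b))

  ≈-trans : ∀ {a b c} → a ≈ b → b ≈ c → a ≈ c
  ≈-trans ≈-exact q = q
  ≈-trans (≈-large e) ≈-exact = ≈-large e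
  ≈-trans (≈-large e) (≈-large f) = ≈-large (trans e f)

  ≈-sym : ∀ {a b} → a ≈ b → b ≈ a
  ≈-sym ≈-exact = ≈-exact
  ≈-sym (≈-large e) = ≈-large (sym e)

  clamp : ℕ → ℕ
  clamp (suc (suc (suc (suc (suc (suc n)))))) = clamp (suc (suc (suc (suc n))))
  clamp n = n

  clamp≈ : ∀ n → clamp n ≈ n
  clamp≈ (suc (suc (suc (suc (suc (suc n)))))) = ≈-trans (clamp≈ (suc (suc (suc (suc n))))) (≈-large refl)
  clamp≈ zero = ≈-exact
  clamp≈ (suc zero) = ≈-exact
  clamp≈ (suc (suc zero)) = ≈-exact
  clamp≈ (suc (suc (suc zero))) = ≈-exact
  clamp≈ (suc (suc (suc (suc zero)))) = ≈-exact
  clamp≈ (suc (suc (suc (suc (suc zero))))) = ≈-exact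

  clamp-suc : ∀ n → Σ ℕ λ m → clamp (suc n) ≡ suc m × m ≈ n
  clamp-suc zero = 0 , refl , ≈-exact
  clamp-suc (suc zero) = 1 , refl , ≈-exact
  clamp-suc (suc (suc zero)) = 2 , refl , ≈-exact
  clamp-suc (suc (suc (suc zero))) = 3 , refl , ≈-exact
  clamp-suc (suc (suc (suc (suc zero)))) = 4 , refl , ≈-exact
  clamp-suc (suc (suc (suc (suc (suc n))))) with clamp-suc (suc (suc (suc n)))
  ... | m , e , r = m , e , ≈-trans r (≈-large refl)

  clamp-elim : (P : ℕ → Set) → P 0 → P 1 → P 2 → P 3 → P 4 → P 5 → ∀ n → P (clamp n)
  clamp-elim P p0 p1 p2 p3 p4 p5 (suc (suc (suc (suc (suc (suc n)))))) = clamp-elim P p0 p1 p2 p3 p4 p5 (suc (suc (suc (suc n))))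
  clamp-elim P p0 p1 p2 p3 p4 p5 zero = p0
  clamp-elim P p0 p1 p2 p3 p4 p5 (suc zero) = p1
  clamp-elim P p0 p1 p2 p3 p4 p5 (suc (suc zero)) = p2
  clamp-elim P p0 p1 p2 p3 p4 p5 (suc (suc (suc zero))) = p3
  clamp-elim P p0 p1 p2 p3 p4 p5 (suc (suc (suc (suc zero)))) = p4
  clamp-elim P p0 p1 p2 p3 p4 p5 (suc (suc (suc (suc (suc zero))))) = p5

  isEven-suc : ∀ n → isEven (suc n) ≡ not (isEven n)
  isEven-suc zero = refl
  isEven-suc (suc zero) = refl
  isEven-suc (suc (suc n)) = isEven-suc n

  isEven-pred : ∀ {a b} → isEven (suc a) ≡ isEven (suc b) → isEven a ≡ isEven b
  isEven-pred {a} {b} e = not-injective (trans (sym (isEven-suc a)) (trans e (isEven-suc b)))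

  valA-resp₁ : ∀ {a b} j → a ≈ b → valA a j ≡ valA b j
  valA-resp₁ j ≈-exact = refl
  valA-resp₁ j (≈-large e) rewrite e = refl

  valA-resp₂ : ∀ i {a b} → a ≈ b → valA i a ≡ valA i b
  valA-resp₂ i ≈-exact = refl
  valA-resp₂ i (≈-large e) with isEven i
  ... | true = refl
  ... | false rewrite e = refl

  valB-resp₁ : ∀ {a b} j → a ≈ b → valB a j ≡ valB b j
  valB-resp₁ j ≈-exact = refl
  valB-resp₁ j (≈-large e) rewrite e = refl

  valB-resp₂ : ∀ i {a b} → a ≈ b → valB i a ≡ valB i b
  valB-resp₂ i ≈-exact = refl
  valB-resp₂ i (≈-large e) rewrite e = refl

  valC-resp₁ : ∀ {a b} j → a ≈ b → valC a j ≡ valC b j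
  valC-resp₁ j ≈-exact = refl
  valC-resp₁ j (≈-large e) rewrite e = refl

  valC-resp₂ : ∀ i {a b} → a ≈ b → valC i a ≡ valC i b
  valC-resp₂ i ≈-exact = refl
  valC-resp₂ i (≈-large e) rewrite e = refl

  val0-resp₁ : ∀ {a b} j → a ≈ b → val0 a j ≡ val0 b j
  val0-resp₁ j ≈-exact = refl
  val0-resp₁ j (≈-large {a} {b} e) rewrite isEven-pred {a} {b} e = refl

  val0-resp₂ : ∀ i {a b} → a ≈ b → val0 i a ≡ val0 i b
  val0-resp₂ i ≈-exact = refl
  val0-resp₂ zero (≈-large e) = refl
  val0-resp₂ (suc i) (≈-large {a} {b} e) with isEven i
  ... | true rewrite e = refl
  ... | false = refl

  valE-resp₁ : ∀ {a b} j → a ≈ b → valE a j ≡ valE b j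
  valE-resp₁ j ≈-exact = refl
  valE-resp₁ j (≈-large e) rewrite e = refl

  valE-resp₂ : ∀ i {a b} → a ≈ b → valE i a ≡ valE i b
  valE-resp₂ i ≈-exact = refl
  valE-resp₂ zero (≈-large e) = refl
  valE-resp₂ (suc zero) (≈-large e) rewrite e = refl
  valE-resp₂ (suc (suc i)) (≈-large e) with isEven i
  ... | true rewrite e = refl
  ... | false rewrite e = refl

  valF-resp₁ : ∀ {a b} j → a ≈ b → valF a j ≡ valF b j
  valF-resp₁ j ≈-exact = refl
  valF-resp₁ j (≈-large {a} {b} e) rewrite isEven-pred {a} {b} e = refl

  valF-resp₂ : ∀ i {a b} → a ≈ b → valF i a ≡ valF i b
  valF-resp₂ i ≈-exact = refl
  valF-resp₂ zero (≈-large e) = refl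
  valF-resp₂ (suc i) (≈-large e) with isEven i
  ... | true rewrite e = refl
  ... | false rewrite e = refl

  valG-resp₁ : ∀ {a b} j → a ≈ b → valG a j ≡ valG b j
  valG-resp₁ j ≈-exact = refl
  valG-resp₁ j (≈-large e) = refl

  valG-resp₂ : ∀ i {a b} → a ≈ b → valG i a ≡ valG i b
  valG-resp₂ i ≈-exact = refl
  valG-resp₂ zero (≈-large e) rewrite e = refl
  valG-resp₂ (suc i) (≈-large e) rewrite e = refl

  valH-resp : ∀ {a b} → a ≈ b → valH a ≡ valH b
  valH-resp ≈-exact = refl
  valH-resp (≈-large e) rewrite e = refl

  valI-resp₁ : ∀ {a b} j → a ≈ b → valI a j ≡ valI b j
  valI-resp₁ j ≈-exact = refl
  valI-resp₁ j (≈-large e) rewrite e = refl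

  valI-resp₂ : ∀ i {a b} → a ≈ b → valI i a ≡ valI i b
  valI-resp₂ i ≈-exact = refl
  valI-resp₂ zero (≈-large e) = refl
  valI-resp₂ (suc zero) (≈-large e) = refl
  valI-resp₂ (suc (suc i)) (≈-large e) with isEven i
  ... | true rewrite e = refl
  ... | false = refl

  valD-resp : ∀ {a b} → a ≈ b → valD a ≡ valD b
  valD-resp ≈-exact = refl
  valD-resp (≈-large e) rewrite e = refl

  value-merged-resp : ∀ {i i′ j j′ k k′} → i ≈ i′ → j ≈ j′ → k ≈ k′ → value (merged i j k) ≡ value (merged i′ j′ k′)
  value-merged-resp {i} {i′} {j} {j′} {k} ri rj ≈-exact with k
  ... | zero = trans (val0-resp₁ j ri) (val0-resp₂ i′ rj)
  ... | suc zero = trans (valA-resp₁ j ri) (valA-resp₂ i′ rj)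
  ... | suc (suc zero) = trans (valB-resp₁ j ri) (valB-resp₂ i′ rj)
  ... | suc (suc (suc _)) = trans (valC-resp₁ j ri) (valC-resp₂ i′ rj)
  value-merged-resp {i} {i′} {j} {j′} ri rj (≈-large e) = trans (valC-resp₁ j ri) (valC-resp₂ i′ rj)

  value-sameEnds-resp : ∀ {i i′ j j′ k k′} → i ≈ i′ → j ≈ j′ → k ≈ k′ → value (sameEnds i j k) ≡ value (sameEnds i′ j′ k′)
  value-sameEnds-resp {i} {i′} {j} {j′} {k} ri rj ≈-exact with k
  ... | zero = trans (valE-resp₁ j ri) (valE-resp₂ i′ rj)
  ... | suc zero = trans (valF-resp₁ j ri) (valF-resp₂ i′ rj)
  ... | suc (suc zero) = trans (valG-resp₁ j ri) (valG-resp₂ i′ rj)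
  ... | suc (suc (suc _)) = valH-resp rj
  value-sameEnds-resp {i} {i′} {j} {j′} ri rj (≈-large e) = valH-resp rj

  value-diffEnds-resp : ∀ {i i′ j j′ k k′} → i ≈ i′ → j ≈ j′ → k ≈ k′ → value (diffEnds i j k) ≡ value (diffEnds i′ j′ k′)
  value-diffEnds-resp {zero} {j = j} {j′} {k} ≈-exact rj rk = trans (valI-resp₁ k rj) (valI-resp₂ j′ rk)
  value-diffEnds-resp {suc i} ≈-exact rj rk = valD-resp rj
  value-diffEnds-resp (≈-large e) rj rk = valD-resp rj

  normalise : Pos → Pos
  normalise (merged i j k) = merged (clamp i) (clamp j) (clamp k)
  normalise (sameEnds i j k) = sameEnds (clamp i) (clamp j) (clamp k)
  normalise (diffEnds i j k) = diffEnds (clamp i) (clamp j) (clamp k)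

  value-normalise : ∀ σ → value (normalise σ) ≡ value σ
  value-normalise (merged i j k) = value-merged-resp (clamp≈ i) (clamp≈ j) (clamp≈ k)
  value-normalise (sameEnds i j k) = value-sameEnds-resp (clamp≈ i) (clamp≈ j) (clamp≈ k)
  value-normalise (diffEnds i j k) = value-diffEnds-resp (clamp≈ i) (clamp≈ j) (clamp≈ k)

  SameValue : Maybe Pos → Maybe Pos → Set
  SameValue nothing nothing = ⊤
  SameValue (just a) (just b) = value a ≡ value b
  SameValue _ _ = ⊥

  ≈-suc : ∀ {a b} → a ≈ b → suc a ≈ suc b
  ≈-suc ≈-exact = ≈-exact
  ≈-suc (≈-large {a} {b} e) = ≈-large (isEven-pred {a} {b} e)

  suc-clamp≈ : ∀ n → suc n ≈ suc (clamp n)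
  suc-clamp≈ n = ≈-suc (≈-sym (clamp≈ n))

  merged-option-normalise : ∀ k i j l → SameValue (option k (merged i j l)) (option k (normalise (merged i j l)))
  merged-option-normalise inner₂ zero j k = tt
  merged-option-normalise inner₂ (suc i) j k with clamp (suc i) | clamp-suc i
  ... | .(suc m) | m , refl , r = value-merged-resp (≈-sym r) (≈-sym (clamp≈ j)) (≈-sym (clamp≈ k))
  merged-option-normalise inner₄ i zero k = tt
  merged-option-normalise inner₄ i (suc j) k with clamp (suc j) | clamp-suc j
  ... | .(suc m) | m , refl , r = value-merged-resp (suc-clamp≈ i) (≈-sym r) (≈-sym (clamp≈ k))
  merged-option-normalise inner₆ i j zero = tt
  merged-option-normalise inner₆ i j (suc k) with clamp (suc k) | clamp-suc k
  ... | .(suc m) | m , refl , r = value-merged-resp (≈-sym (clamp≈ i)) (suc-clamp≈ j) (≈-sym r)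
  merged-option-normalise flipEnd zero zero zero = tt
  merged-option-normalise flipEnd (suc i) j k with clamp (suc i) | clamp-suc i
  ... | .(suc m) | m , refl , r = value-merged-resp {k = 0} {k′ = 0} (≈-sym (clamp≈ j)) (≈-sym (clamp≈ k)) ≈-exact
  merged-option-normalise flipEnd zero (suc j) k with clamp (suc j) | clamp-suc j
  ... | .(suc m) | m , refl , r = value-merged-resp {k = 0} {k′ = 0} (≈-suc (≈-sym r)) (≈-sym (clamp≈ k)) ≈-exact
  merged-option-normalise flipEnd zero zero (suc k) with clamp (suc k) | clamp-suc k
  ... | .(suc m) | m , refl , r = value-merged-resp {i = 0} {i′ = 0} {k = 0} {k′ = 0} ≈-exact (≈-suc (≈-sym r)) ≈-exact

  sameEnds-option-normalise : ∀ k i j l → SameValue (option k (sameEnds i j l)) (option k (normalise (sameEnds i j l)))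
  sameEnds-option-normalise inner₂ zero j k = tt
  sameEnds-option-normalise inner₂ (suc i) j k with clamp (suc i) | clamp-suc i
  ... | .(suc m) | m , refl , r = value-merged-resp (≈-sym r) (≈-sym (clamp≈ j)) (≈-sym (clamp≈ k))
  sameEnds-option-normalise inner₄ i zero k = tt
  sameEnds-option-normalise inner₄ i (suc j) k with clamp (suc j) | clamp-suc j
  ... | .(suc m) | m , refl , r = value-sameEnds-resp (suc-clamp≈ i) (≈-sym r) (≈-sym (clamp≈ k))
  sameEnds-option-normalise inner₆ i j zero = tt
  sameEnds-option-normalise inner₆ i j (suc k) with clamp (suc k) | clamp-suc k
  ... | .(suc m) | m , refl , r = value-sameEnds-resp (≈-sym (clamp≈ i)) (suc-clamp≈ j) (≈-sym r)
  sameEnds-option-normalise flipEnd zero zero zero = tt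
  sameEnds-option-normalise flipEnd (suc i) j k with clamp (suc i) | clamp-suc i
  ... | .(suc m) | m , refl , r = value-diffEnds-resp (≈-suc (≈-sym r)) (≈-sym (clamp≈ j)) (≈-sym (clamp≈ k))
  sameEnds-option-normalise flipEnd zero (suc j) k with clamp (suc j) | clamp-suc j
  ... | .(suc m) | m , refl , r = value-diffEnds-resp {i = 0} {i′ = 0} ≈-exact (≈-suc (≈-sym r)) (≈-sym (clamp≈ k))
  sameEnds-option-normalise flipEnd zero zero (suc k) with clamp (suc k) | clamp-suc k
  ... | .(suc m) | m , refl , r = value-diffEnds-resp {i = 0} {i′ = 0} {j = 0} {j′ = 0} ≈-exact ≈-exact (≈-suc (≈-sym r))

  diffEnds-option-normalise : ∀ k e i j → SameValue (option k (diffEnds e i j)) (option k (normalise (diffEnds e i j)))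
  diffEnds-option-normalise inner₂ e i j = tt
  diffEnds-option-normalise inner₄ e zero j = tt
  diffEnds-option-normalise inner₄ e (suc i) j with clamp (suc i) | clamp-suc i
  ... | .(suc m) | m , refl , r = value-diffEnds-resp (suc-clamp≈ e) (≈-sym r) (≈-sym (clamp≈ j))
  diffEnds-option-normalise inner₆ e i zero = tt
  diffEnds-option-normalise inner₆ e i (suc j) with clamp (suc j) | clamp-suc j
  ... | .(suc m) | m , refl , r = value-diffEnds-resp (≈-sym (clamp≈ e)) (suc-clamp≈ i) (≈-sym r)
  diffEnds-option-normalise flipEnd (suc e) i j with clamp (suc e) | clamp-suc e
  ... | .(suc m) | m , refl , r = value-merged-resp {k = 0} {k′ = 0} (≈-sym (clamp≈ i)) (≈-sym (clamp≈ j)) ≈-exact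
  diffEnds-option-normalise flipEnd zero zero zero = tt
  diffEnds-option-normalise flipEnd zero (suc i) j with clamp (suc i) | clamp-suc i
  ... | .(suc m) | m , refl , r = value-sameEnds-resp {k = 0} {k′ = 0} (≈-suc (≈-sym r)) (≈-sym (clamp≈ j)) ≈-exact
  diffEnds-option-normalise flipEnd zero zero (suc j) with clamp (suc j) | clamp-suc j
  ... | .(suc m) | m , refl , r = value-sameEnds-resp {i = 0} {i′ = 0} {k = 0} {k′ = 0} ≈-exact (≈-suc (≈-sym r)) ≈-exact

  option-normalise : ∀ k σ → SameValue (option k σ) (option k (normalise σ))
  option-normalise k (merged i j l) = merged-option-normalise k i j l
  option-normalise k (sameEnds i j l) = sameEnds-option-normalise k i j l
  option-normalise k (diffEnds e i j) = diffEnds-option-normalise k e i j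

  avoids : Maybe Pos → ℕ → Bool
  avoids nothing v = true
  avoids (just τ) v = not (value τ ≡ᵇ v)

  hits : Maybe Pos → ℕ → Bool
  hits nothing m = false
  hits (just τ) m = value τ ≡ᵇ m

  mexHolds : Pos → Bool
  mexHolds σ = (avoids (option inner₂ σ) (value σ) ∧ avoids (option inner₄ σ) (value σ) ∧ avoids (option inner₆ σ) (value σ) ∧ avoids (option flipEnd σ) (value σ))
    ∧ allBelow (value σ) (λ m → hits (option inner₂ σ) m ∨ hits (option inner₄ σ) m ∨ hits (option inner₆ σ) m ∨ hits (option flipEnd σ) m)

  upTo6 : (ℕ → Bool) → Bool
  upTo6 f = f 0 ∧ f 1 ∧ f 2 ∧ f 3 ∧ f 4 ∧ f 5

  mexHolds₃ : ℕ → ℕ → ℕ → Bool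
  mexHolds₃ a b c = mexHolds (merged a b c) ∧ mexHolds (sameEnds a b c) ∧ mexHolds (diffEnds a b c)

  mexHolds-small : Bool
  mexHolds-small = upTo6 (λ a → upTo6 (λ b → upTo6 (λ c → mexHolds₃ a b c)))

  mexHolds-small-ok : T mexHolds-small
  mexHolds-small-ok = tt

  upTo6-clamp : ∀ {f} → T (upTo6 f) → ∀ n → T (f (clamp n))
  upTo6-clamp {f} p = clamp-elim (λ x → T (f x)) (T-∧-fst′ (f 0) _ p) (T-∧-fst′ (f 1) _ p1) (T-∧-fst′ (f 2) _ p2) (T-∧-fst′ (f 3) _ p3) (T-∧-fst′ (f 4) _ p4) (T-∧-snd′ (f 4) _ p4)
    where
    p1 = T-∧-snd′ (f 0) _ p
    p2 = T-∧-snd′ (f 1) _ p1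
    p3 = T-∧-snd′ (f 2) _ p2
    p4 = T-∧-snd′ (f 3) _ p3

  mexHolds₃-clamp : ∀ a b c → T (mexHolds₃ (clamp a) (clamp b) (clamp c))
  mexHolds₃-clamp a b c = upTo6-clamp {λ z → mexHolds₃ (clamp a) (clamp b) z} (upTo6-clamp {λ y → upTo6 (λ z → mexHolds₃ (clamp a) y z)} (upTo6-clamp {λ x → upTo6 (λ y → upTo6 (λ z → mexHolds₃ x y z))} mexHolds-small-ok a) b) c

  mexHolds-normalise : ∀ σ → T (mexHolds (normalise σ))
  mexHolds-normalise (merged a b c) = T-∧-fst′ (mexHolds (merged (clamp a) (clamp b) (clamp c))) _ (mexHolds₃-clamp a b c)
  mexHolds-normalise (sameEnds a b c) = T-∧-fst′ (mexHolds (sameEnds (clamp a) (clamp b) (clamp c))) _ (T-∧-snd′ (mexHolds (merged (clamp a) (clamp b) (clamp c))) _ (mexHolds₃-clamp a b c))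
  mexHolds-normalise (diffEnds a b c) = T-∧-snd′ (mexHolds (sameEnds (clamp a) (clamp b) (clamp c))) _ (T-∧-snd′ (mexHolds (merged (clamp a) (clamp b) (clamp c))) _ (mexHolds₃-clamp a b c))

  avoids-sound : ∀ mτ v → T (avoids mτ v) → ∀ τ → mτ ≡ just τ → value τ ≢ v
  avoids-sound nothing v p τ ()
  avoids-sound (just τ) v p .τ refl e with value τ ≡ᵇ v | ≡⇒≡ᵇ (value τ) v e
  ... | true | _ = p
  ... | false | ()

  hits-sound : ∀ mτ m → T (hits mτ m) → Σ Pos (λ τ → mτ ≡ just τ × value τ ≡ m)
  hits-sound nothing m ()
  hits-sound (just τ) m p = τ , refl , ≡ᵇ⇒≡ (value τ) m p

  normalise-avoids : ∀ k σ → T (avoids (option k (normalise σ)) (value (normalise σ)))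
  normalise-avoids k σ = byKind k (mexHolds-normalise σ) where
    ρ = normalise σ
    a = avoids (option inner₂ ρ) (value ρ)
    b = avoids (option inner₄ ρ) (value ρ)
    c = avoids (option inner₆ ρ) (value ρ)
    d = avoids (option flipEnd ρ) (value ρ)
    e = allBelow (value ρ) (λ m → hits (option inner₂ ρ) m ∨ hits (option inner₄ ρ) m ∨ hits (option inner₆ ρ) m ∨ hits (option flipEnd ρ) m)
    byKind : ∀ k → T ((a ∧ b ∧ c ∧ d) ∧ e) → T (avoids (option k ρ) (value ρ))
    byKind inner₂ p = T-∧-fst′ a _ (T-∧-fst′ (a ∧ b ∧ c ∧ d) e p)
    byKind inner₄ p = T-∧-fst′ b _ (T-∧-snd′ a _ (T-∧-fst′ (a ∧ b ∧ c ∧ d) e p))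
    byKind inner₆ p = T-∧-fst′ c _ (T-∧-snd′ b _ (T-∧-snd′ a _ (T-∧-fst′ (a ∧ b ∧ c ∧ d) e p)))
    byKind flipEnd p = T-∧-snd′ c _ (T-∧-snd′ b _ (T-∧-snd′ a _ (T-∧-fst′ (a ∧ b ∧ c ∧ d) e p)))

  normalise-mex : ∀ σ m → m < value (normalise σ) → Σ MoveKind λ k → Σ Pos λ τ → option k (normalise σ) ≡ just τ × value τ ≡ m
  normalise-mex σ m lt with T-∨-split (allBelow-sound _ _ (T-∧-snd′ (avoids (option inner₂ (normalise σ)) (value (normalise σ)) ∧ avoids (option inner₄ (normalise σ)) (value (normalise σ)) ∧ avoids (option inner₆ (normalise σ)) (value (normalise σ)) ∧ avoids (option flipEnd (normalise σ)) (value (normalise σ))) _ (mexHolds-normalise σ)) m lt)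
  ... | inj₁ p = inner₂ , hits-sound _ m p
  ... | inj₂ p with T-∨-split p
  ... | inj₁ p2 = inner₄ , hits-sound _ m p2
  ... | inj₂ p2 with T-∨-split p2
  ... | inj₁ p3 = inner₆ , hits-sound _ m p3
  ... | inj₂ p3 = flipEnd , hits-sound _ m p3

  option-value-≢′ : ∀ (a b : Maybe Pos) v w → SameValue a b → T (avoids b w) → v ≡ w → ∀ σ' → a ≡ just σ' → value σ' ≢ v
  option-value-≢′ (just x) (just y) v w c p refl .x refl e = avoids-sound (just y) w p y refl (trans (sym c) e)
  option-value-≢′ (just x) nothing v w () p vw σ' eq
  option-value-≢′ nothing b v w c p vw σ' ()

  option-value-≢ : ∀ k σ σ' → option k σ ≡ just σ' → value σ' ≢ value σ
  option-value-≢ k σ σ' eq = option-value-≢′ (option k σ) (option k (normalise σ)) (value σ) (value (normalise σ)) (option-normalise k σ) (normalise-avoids k σ) (sym (value-normalise σ)) σ' eq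

  SameValue-back : ∀ (a b : Maybe Pos) τ → SameValue a b → b ≡ just τ → Σ Pos λ x → a ≡ just x × value x ≡ value τ
  SameValue-back (just x) (just y) .y c refl = x , refl , c
  SameValue-back nothing (just y) τ () e
  SameValue-back a nothing τ c ()

  option-value-below : ∀ σ m → m < value σ → Σ MoveKind λ k → Σ Pos λ σ' → option k σ ≡ just σ' × value σ' ≡ m
  option-value-below σ m lt with normalise-mex σ m (subst (m <_) (sym (value-normalise σ)) lt)
  ... | k , τ , e , v with SameValue-back (option k σ) (option k (normalise σ)) τ (option-normalise k σ) e
  ... | x , e2 , v2 = k , x , e2 , trans v2 v

  size : Pos → ℕ
  size (merged i j k) = 2 * i + 4 * j + 6 * k
  size (sameEnds i j k) = 2 * i + 4 * j + 6 * k
  size (diffEnds e i j) = e + 3 * i + 5 * j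

  <-via-+ : ∀ a b d → b ≡ a + suc d → a < b
  <-via-+ a b d refl = m<m+n a (s≤s z≤n)

  merged-size-< : ∀ k i j l σ′ → option k (merged i j l) ≡ just σ′ → size σ′ < size (merged i j l)
  merged-size-< inner₂ (suc i) j k _ refl = <-via-+ _ _ 1 (e i j k) where
    e : ∀ i j k → 2 * suc i + 4 * j + 6 * k ≡ (2 * i + 4 * j + 6 * k) + 2
    e = solve-∀
  merged-size-< inner₄ i (suc j) k _ refl = <-via-+ _ _ 1 (e i j k) where
    e : ∀ i j k → 2 * i + 4 * suc j + 6 * k ≡ (2 * suc i + 4 * j + 6 * k) + 2
    e = solve-∀
  merged-size-< inner₆ i j (suc k) _ refl = <-via-+ _ _ 1 (e i j k) where
    e : ∀ i j k → 2 * i + 4 * j + 6 * suc k ≡ (2 * i + 4 * suc j + 6 * k) + 2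
    e = solve-∀
  merged-size-< flipEnd (suc i) j k _ refl = <-via-+ _ _ (i + i + j + j + k + k + 1) (e i j k) where
    e : ∀ i j k → 2 * suc i + 4 * j + 6 * k ≡ (2 * j + 4 * k + 6 * 0) + suc (i + i + j + j + k + k + 1)
    e = solve-∀
  merged-size-< flipEnd zero (suc j) k _ refl = <-via-+ _ _ (j + j + k + k + 1) (e j k) where
    e : ∀ j k → 2 * 0 + 4 * suc j + 6 * k ≡ (2 * suc j + 4 * k + 6 * 0) + suc (j + j + k + k + 1)
    e = solve-∀
  merged-size-< flipEnd zero zero (suc k) _ refl = <-via-+ _ _ (k + k + 1) (e k) where
    e : ∀ k → 2 * 0 + 4 * 0 + 6 * suc k ≡ (2 * 0 + 4 * suc k + 6 * 0) + suc (k + k + 1)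
    e = solve-∀

  sameEnds-size-< : ∀ k i j l σ′ → option k (sameEnds i j l) ≡ just σ′ → size σ′ < size (sameEnds i j l)
  sameEnds-size-< inner₂ (suc i) j k _ refl = <-via-+ _ _ 1 (e i j k) where
    e : ∀ i j k → 2 * suc i + 4 * j + 6 * k ≡ (2 * i + 4 * j + 6 * k) + 2
    e = solve-∀
  sameEnds-size-< inner₄ i (suc j) k _ refl = <-via-+ _ _ 1 (e i j k) where
    e : ∀ i j k → 2 * i + 4 * suc j + 6 * k ≡ (2 * suc i + 4 * j + 6 * k) + 2
    e = solve-∀
  sameEnds-size-< inner₆ i j (suc k) _ refl = <-via-+ _ _ 1 (e i j k) where
    e : ∀ i j k → 2 * i + 4 * j + 6 * suc k ≡ (2 * i + 4 * suc j + 6 * k) + 2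
    e = solve-∀
  sameEnds-size-< flipEnd (suc i) j k _ refl = <-via-+ _ _ (i + j + k) (e i j k) where
    e : ∀ i j k → 2 * suc i + 4 * j + 6 * k ≡ (suc i + 3 * j + 5 * k) + suc (i + j + k)
    e = solve-∀
  sameEnds-size-< flipEnd zero (suc j) k _ refl = <-via-+ _ _ (j + k) (e j k) where
    e : ∀ j k → 2 * 0 + 4 * suc j + 6 * k ≡ (0 + 3 * suc j + 5 * k) + suc (j + k)
    e = solve-∀
  sameEnds-size-< flipEnd zero zero (suc k) _ refl = <-via-+ _ _ k (e k) where
    e : ∀ k → 2 * 0 + 4 * 0 + 6 * suc k ≡ (0 + 3 * 0 + 5 * suc k) + suc k
    e = solve-∀

  diffEnds-size-< : ∀ k e i j σ′ → option k (diffEnds e i j) ≡ just σ′ → size σ′ < size (diffEnds e i j)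
  diffEnds-size-< inner₄ e (suc i) j _ refl = <-via-+ _ _ 1 (q e i j) where
    q : ∀ e i j → e + 3 * suc i + 5 * j ≡ (suc e + 3 * i + 5 * j) + 2
    q = solve-∀
  diffEnds-size-< inner₆ e i (suc j) _ refl = <-via-+ _ _ 1 (q e i j) where
    q : ∀ e i j → e + 3 * i + 5 * suc j ≡ (e + 3 * suc i + 5 * j) + 2
    q = solve-∀
  diffEnds-size-< flipEnd (suc e) i j _ refl = <-via-+ _ _ (e + i + j) (q e i j) where
    q : ∀ e i j → suc e + 3 * i + 5 * j ≡ (2 * i + 4 * j + 6 * 0) + suc (e + i + j)
    q = solve-∀
  diffEnds-size-< flipEnd zero (suc i) j _ refl = <-via-+ _ _ (i + j) (q i j) where
    q : ∀ i j → 0 + 3 * suc i + 5 * j ≡ (2 * suc i + 4 * j + 6 * 0) + suc (i + j)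
    q = solve-∀
  diffEnds-size-< flipEnd zero zero (suc j) _ refl = <-via-+ _ _ j (q j) where
    q : ∀ j → 0 + 3 * 0 + 5 * suc j ≡ (2 * 0 + 4 * suc j + 6 * 0) + suc j
    q = solve-∀

  option-size-< : ∀ k σ σ′ → option k σ ≡ just σ′ → size σ′ < size σ
  option-size-< k (merged i j l) = merged-size-< k i j l
  option-size-< k (sameEnds i j l) = sameEnds-size-< k i j l
  option-size-< k (diffEnds e i j) = diffEnds-size-< k e i j

module Multiplicity where

  indicator : ℕ → ℕ → ℕ
  indicator x k = if x ≡ᵇ k then 1 else 0

  count : ∀ n → (Fin n → ℕ) → ℕ → ℕ
  count zero f k = 0
  count (suc n) f k = indicator (f zero) k + count n (λ p → f (suc p)) k

  ≡ᵇ-refl : ∀ x → (x ≡ᵇ x) ≡ true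
  ≡ᵇ-refl zero = refl
  ≡ᵇ-refl (suc x) = ≡ᵇ-refl x

  indicator-≡ : ∀ x → indicator x x ≡ 1
  indicator-≡ x rewrite ≡ᵇ-refl x = refl

  indicator-≢ : ∀ x k → x ≢ k → indicator x k ≡ 0
  indicator-≢ x k ne with x ≡ᵇ k in eq
  ... | true = ⊥-elim (ne (≡ᵇ⇒≡ x k (subst T (sym eq) _)))
  ... | false = refl

  count-cong : ∀ n (f g : Fin n → ℕ) → (∀ p → f p ≡ g p) → ∀ k → count n f k ≡ count n g k
  count-cong zero f g e k = refl
  count-cong (suc n) f g e k rewrite e zero = cong (indicator (g zero) k +_) (count-cong n _ _ (λ p → e (suc p)) k)

  count-absent : ∀ n (f : Fin n → ℕ) k → (∀ p → f p ≢ k) → count n f k ≡ 0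
  count-absent zero f k h = refl
  count-absent (suc n) f k h rewrite indicator-≢ (f zero) k (h zero) = count-absent n _ k (λ p → h (suc p))

  count-nonzero : ∀ n (f : Fin n → ℕ) k → count n f k ≢ 0 → Σ (Fin n) λ p → f p ≡ k
  count-nonzero zero f k ne = ⊥-elim (ne refl)
  count-nonzero (suc n) f k ne with f zero ≟ k
  ... | yes e = zero , e
  ... | no fe with count-nonzero n (λ p → f (suc p)) k (λ z → ne (trans (cong (_+ count n (λ p → f (suc p)) k) (indicator-≢ (f zero) k fe)) z))
  ... | p , e = suc p , e

  count-member : ∀ n (f : Fin n → ℕ) p → count n f (f p) ≢ 0
  count-member (suc n) f zero e rewrite indicator-≡ (f zero) with e
  ... | ()
  count-member (suc n) f (suc p) e = count-member n (λ q → f (suc q)) p (m+n≡0⇒n≡0 (indicator (f zero) (f (suc p))) e)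

  count-pred : ∀ n (f g : Fin n → ℕ) → (∀ p → suc (g p) ≡ f p) → ∀ k → count n g k ≡ count n f (suc k)
  count-pred zero f g e k = refl
  count-pred (suc n) f g e k rewrite sym (e zero) = cong (indicator (g zero) k +_) (count-pred n _ _ (λ p → e (suc p)) k)

  count-∸2-zero : ∀ n (f g : Fin n → ℕ) → (∀ p → g p ≡ f p ∸ 2) → (∀ p → f p ≢ 1) → count n g 0 ≡ count n f 0 + count n f 2
  count-∸2-zero zero f g e h = refl
  count-∸2-zero (suc n) f g e h with f zero | e zero | h zero
  ... | zero | e0 | _ rewrite e0 = cong suc (count-∸2-zero n _ _ (λ p → e (suc p)) (λ p → h (suc p)))
  ... | suc zero | e0 | h0 = ⊥-elim (h0 refl)
  ... | suc (suc zero) | e0 | _ rewrite e0 = trans (cong suc (count-∸2-zero n _ _ (λ p → e (suc p)) (λ p → h (suc p)))) (sym (+-suc _ _))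
  ... | suc (suc (suc x)) | e0 | _ rewrite e0 = count-∸2-zero n _ _ (λ p → e (suc p)) (λ p → h (suc p))

  count-∸2-suc : ∀ n (f g : Fin n → ℕ) → (∀ p → g p ≡ f p ∸ 2) → (∀ p → f p ≢ 1) → ∀ k → count n g (suc k) ≡ count n f (suc (suc (suc k)))
  count-∸2-suc zero f g e h k = refl
  count-∸2-suc (suc n) f g e h k with f zero | e zero | h zero
  ... | zero | e0 | _ rewrite e0 = count-∸2-suc n _ _ (λ p → e (suc p)) (λ p → h (suc p)) k
  ... | suc zero | e0 | h0 = ⊥-elim (h0 refl)
  ... | suc (suc x) | e0 | _ rewrite e0 = cong (indicator x (suc k) +_) (count-∸2-suc n _ _ (λ p → e (suc p)) (λ p → h (suc p)) k)

  +-swap-outer : ∀ a b c → (a + b) + c ≡ (c + b) + a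
  +-swap-outer = solve-∀

  +-assoc-≡ : ∀ a b c d → b + c ≡ d → (a + b) + c ≡ a + d
  +-assoc-≡ a b c d e = trans (+-assoc a b c) (cong (a +_) e)

  count-update : ∀ n (f g : Fin n → ℕ) p0 → (∀ p → p ≢ p0 → g p ≡ f p) → ∀ k → count n g k + indicator (f p0) k ≡ count n f k + indicator (g p0) k
  count-update (suc n) f g zero h k rewrite count-cong n (λ p → g (suc p)) (λ p → f (suc p)) (λ p → h (suc p) (λ ())) k = +-swap-outer (indicator (g zero) k) _ (indicator (f zero) k)
  count-update (suc n) f g (suc p0) h k rewrite h zero (λ ()) = trans (+-assoc-≡ (indicator (f zero) k) _ _ _ (count-update n _ _ p0 (λ p ne → h (suc p) (λ e → ne (Fin.suc-injective e))) k)) (sym (+-assoc (indicator (f zero) k) _ _))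

module Encoding where

  open AbstractGame
  open Multiplicity

  -- A monochromatic u–v path (a count c 0 > 0) puts u and v in one component.
  encodeApart : ℕ → (ℕ → ℕ) → Bool → Pos
  encodeApart zero c true = diffEnds (c 1) (c 3) (c 5)
  encodeApart zero c false = sameEnds (c 2) (c 4) (c 6)
  encodeApart (suc _) c par = merged (c 2) (c 4) (c 6)

  encode : Bool → (ℕ → ℕ) → Bool → Pos
  encode false c par = merged (c 2) (c 4) (c 6)
  encode true c par = encodeApart (c 0) c par

  record Admissible (s : Bool) (c : ℕ → ℕ) (par : Bool) : Set where
    field
      vanish-≥7 : ∀ k → 7 ≤ k → c k ≡ 0
      parity : ∀ k → c k ≢ 0 → isEven k ≡ not (s ∧ par)

  +0-cancel : ∀ {x y} → x + 0 ≡ y + 0 → x ≡ y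
  +0-cancel {x} {y} e = trans (sym (+-identityʳ x)) (trans e (+-identityʳ y))

  +1≡+0⇒suc : ∀ {x y} → x + 1 ≡ y + 0 → y ≡ suc x
  +1≡+0⇒suc {x} {y} e = trans (sym (+-identityʳ y)) (trans (sym e) (+-comm x 1))

  +0≡+1⇒suc : ∀ {x y} → x + 0 ≡ y + 1 → x ≡ suc y
  +0≡+1⇒suc {x} {y} e = +1≡+0⇒suc (sym e)

  suc≢0 : ∀ {x y} → x ≡ suc y → x ≢ 0
  suc≢0 refl ()

  absent-by-parity : ∀ {s c par} → Admissible s c par → ∀ k → isEven k ≢ not (s ∧ par) → c k ≡ 0
  absent-by-parity {c = c} inv k ne with c k ≟ 0
  ... | yes e = e
  ... | no e = ⊥-elim (ne (Admissible.parity inv k e))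

  merged-inner₂ : ∀ {a a' b b' d d'} → a ≡ suc a' → b' ≡ b → d' ≡ d → option inner₂ (merged a b d) ≡ just (merged a' b' d')
  merged-inner₂ refl refl refl = refl
  sameEnds-inner₂ : ∀ {a a' b b' d d'} → a ≡ suc a' → b' ≡ b → d' ≡ d → option inner₂ (sameEnds a b d) ≡ just (merged a' b' d')
  sameEnds-inner₂ refl refl refl = refl
  merged-inner₄ : ∀ {a a' b b' d d'} → a' ≡ suc a → b ≡ suc b' → d' ≡ d → option inner₄ (merged a b d) ≡ just (merged a' b' d')
  merged-inner₄ refl refl refl = refl
  sameEnds-inner₄ : ∀ {a a' b b' d d'} → a' ≡ suc a → b ≡ suc b' → d' ≡ d → option inner₄ (sameEnds a b d) ≡ just (sameEnds a' b' d')
  sameEnds-inner₄ refl refl refl = refl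
  merged-inner₆ : ∀ {a a' b b' d d'} → a' ≡ a → b' ≡ suc b → d ≡ suc d' → option inner₆ (merged a b d) ≡ just (merged a' b' d')
  merged-inner₆ refl refl refl = refl
  sameEnds-inner₆ : ∀ {a a' b b' d d'} → a' ≡ a → b' ≡ suc b → d ≡ suc d' → option inner₆ (sameEnds a b d) ≡ just (sameEnds a' b' d')
  sameEnds-inner₆ refl refl refl = refl
  diffEnds-inner₄ : ∀ {a a' b b' d d'} → a' ≡ suc a → b ≡ suc b' → d' ≡ d → option inner₄ (diffEnds a b d) ≡ just (diffEnds a' b' d')
  diffEnds-inner₄ refl refl refl = refl
  diffEnds-inner₆ : ∀ {a a' b b' d d'} → a' ≡ a → b' ≡ suc b → d ≡ suc d' → option inner₆ (diffEnds a b d) ≡ just (diffEnds a' b' d')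
  diffEnds-inner₆ refl refl refl = refl

  parity-even : ∀ {s c par k} → Admissible s c par → c k ≢ 0 → isEven k ≡ true → (s ∧ par) ≡ false
  parity-even {s} {c} {par} inv ne ev with s ∧ par | Admissible.parity inv _ ne
  ... | false | _ = refl
  ... | true | e = trans (sym ev) e

  parity-odd : ∀ {s c par k} → Admissible s c par → c k ≢ 0 → isEven k ≡ false → (s ∧ par) ≡ true
  parity-odd {s} {c} {par} inv ne ev with s ∧ par | Admissible.parity inv _ ne
  ... | true | _ = refl
  ... | false | e = trans (sym ev) e

  encodeApart-inner₂ : ∀ x y c c' par → y ≡ suc x → par ≡ false → c 2 ≡ suc (c' 2) → c' 4 ≡ c 4 → c' 6 ≡ c 6 → option inner₂ (encodeApart x c par) ≡ just (encodeApart y c' par)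
  encodeApart-inner₂ zero .(suc zero) c c' false refl h A B C = sameEnds-inner₂ A B C
  encodeApart-inner₂ (suc x) .(suc (suc x)) c c' par refl h A B C = merged-inner₂ A B C

  encodeApart-inner₄ : ∀ x y c c' par → y ≡ x → par ≡ false → c' 2 ≡ suc (c 2) → c 4 ≡ suc (c' 4) → c' 6 ≡ c 6 → option inner₄ (encodeApart x c par) ≡ just (encodeApart y c' par)
  encodeApart-inner₄ zero .zero c c' false refl h A B C = sameEnds-inner₄ A B C
  encodeApart-inner₄ (suc x) .(suc x) c c' par refl h A B C = merged-inner₄ A B C

  encodeApart-inner₆ : ∀ x y c c' par → y ≡ x → par ≡ false → c' 2 ≡ c 2 → c' 4 ≡ suc (c 4) → c 6 ≡ suc (c' 6) → option inner₆ (encodeApart x c par) ≡ just (encodeApart y c' par)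
  encodeApart-inner₆ zero .zero c c' false refl h A B C = sameEnds-inner₆ A B C
  encodeApart-inner₆ (suc x) .(suc x) c c' par refl h A B C = merged-inner₆ A B C

  kindOf : ℕ → MoveKind
  kindOf (suc (suc zero)) = inner₂
  kindOf (suc (suc (suc zero))) = inner₄
  kindOf (suc (suc (suc (suc zero)))) = inner₄
  kindOf _ = inner₆

  encode-inner : ∀ s c c' par r0 → Admissible s c par → 2 ≤ r0 → r0 ≤ 6 → c r0 ≢ 0
      → (∀ k → c' k + indicator r0 k ≡ c k + indicator (r0 ∸ 2) k)
      → option (kindOf r0) (encode s c par) ≡ just (encode s c' par)
  encode-inner false c c' par (suc (suc zero)) inv _ _ nzr eq = merged-inner₂ (+1≡+0⇒suc (eq 2)) (+0-cancel (eq 4)) (+0-cancel (eq 6))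
  encode-inner true c c' par (suc (suc zero)) inv _ _ nzr eq = encodeApart-inner₂ (c 0) (c' 0) c c' par (+0≡+1⇒suc (eq 0)) (parity-even inv nzr refl) (+1≡+0⇒suc (eq 2)) (+0-cancel (eq 4)) (+0-cancel (eq 6))
  encode-inner false c c' par (suc (suc (suc (suc zero)))) inv _ _ nzr eq = merged-inner₄ (+0≡+1⇒suc (eq 2)) (+1≡+0⇒suc (eq 4)) (+0-cancel (eq 6))
  encode-inner true c c' par (suc (suc (suc (suc zero)))) inv _ _ nzr eq = encodeApart-inner₄ (c 0) (c' 0) c c' par (+0-cancel (eq 0)) (parity-even inv nzr refl) (+0≡+1⇒suc (eq 2)) (+1≡+0⇒suc (eq 4)) (+0-cancel (eq 6))
  encode-inner false c c' par (suc (suc (suc (suc (suc (suc zero)))))) inv _ _ nzr eq = merged-inner₆ (+0-cancel (eq 2)) (+0≡+1⇒suc (eq 4)) (+1≡+0⇒suc (eq 6))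
  encode-inner true c c' par (suc (suc (suc (suc (suc (suc zero)))))) inv _ _ nzr eq = encodeApart-inner₆ (c 0) (c' 0) c c' par (+0-cancel (eq 0)) (parity-even inv nzr refl) (+0-cancel (eq 2)) (+0≡+1⇒suc (eq 4)) (+1≡+0⇒suc (eq 6))
  encode-inner false c c' par (suc (suc (suc zero))) inv _ _ nzr eq with parity-odd inv nzr refl
  ... | ()
  encode-inner false c c' par (suc (suc (suc (suc (suc zero))))) inv _ _ nzr eq with parity-odd inv nzr refl
  ... | ()
  encode-inner true c c' false (suc (suc (suc zero))) inv _ _ nzr eq with parity-odd inv nzr refl
  ... | ()
  encode-inner true c c' true (suc (suc (suc zero))) inv _ _ nzr eq = apartDiffEnds (c 0) (c' 0) refl (+0-cancel (eq 0)) (absent-by-parity inv 0 (λ ())) where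
    apartDiffEnds : ∀ x y → c 0 ≡ x → y ≡ x → c 0 ≡ 0 → option inner₄ (encodeApart x c true) ≡ just (encodeApart y c' true)
    apartDiffEnds zero .zero _ refl _ = diffEnds-inner₄ (+0≡+1⇒suc (eq 1)) (+1≡+0⇒suc (eq 3)) (+0-cancel (eq 5))
    apartDiffEnds (suc x) _ h _ z = ⊥-elim (suc≢0 h z)
  encode-inner true c c' false (suc (suc (suc (suc (suc zero))))) inv _ _ nzr eq with parity-odd inv nzr refl
  ... | ()
  encode-inner true c c' true (suc (suc (suc (suc (suc zero))))) inv _ _ nzr eq = apartDiffEnds (c 0) (c' 0) refl (+0-cancel (eq 0)) (absent-by-parity inv 0 (λ ())) where
    apartDiffEnds : ∀ x y → c 0 ≡ x → y ≡ x → c 0 ≡ 0 → option inner₆ (encodeApart x c true) ≡ just (encodeApart y c' true)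
    apartDiffEnds zero .zero _ refl _ = diffEnds-inner₆ (+0-cancel (eq 1)) (+0≡+1⇒suc (eq 3)) (+1≡+0⇒suc (eq 5))
    apartDiffEnds (suc x) _ h _ z = ⊥-elim (suc≢0 h z)
  encode-inner s c c' par zero inv () _ nzr eq
  encode-inner s c c' par (suc zero) inv (s≤s ()) _ nzr eq
  encode-inner s c c' par (suc (suc (suc (suc (suc (suc (suc r))))))) inv _ (s≤s (s≤s (s≤s (s≤s (s≤s (s≤s ())))))) nzr eq

  diffEnds-flip : ∀ (c' : ℕ → ℕ) e i j → c' 0 ≡ e → c' 2 ≡ i → c' 4 ≡ j → c' 6 ≡ 0 → (e ≡ 0 → i ≡ 0 → j ≡ 0 → ⊥)
     → option flipEnd (diffEnds e i j) ≡ just (encodeApart (c' 0) c' false)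
  diffEnds-flip c' .(c' 0) .(c' 2) .(c' 4) refl refl refl C nzz with c' 0
  ... | suc _ rewrite C = refl
  ... | zero with c' 2 | c' 4
  ... | zero | zero = ⊥-elim (nzz refl refl refl)
  ... | suc _ | _ rewrite C = refl
  ... | zero | suc _ rewrite C = refl

  sameEnds-flip : ∀ (c' : ℕ → ℕ) i j k → c' 0 ≡ 0 → c' 1 ≡ i → c' 3 ≡ j → c' 5 ≡ k → (i ≡ 0 → j ≡ 0 → k ≡ 0 → ⊥)
     → option flipEnd (sameEnds i j k) ≡ just (encodeApart (c' 0) c' true)
  sameEnds-flip c' .(c' 1) .(c' 3) .(c' 5) h0 refl refl refl nzz rewrite h0 with c' 1 | c' 3 | c' 5
  ... | zero | zero | zero = ⊥-elim (nzz refl refl refl)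
  ... | suc _ | _ | _ = refl
  ... | zero | suc _ | _ = refl
  ... | zero | zero | suc _ = refl

  merged-flip : ∀ (c' : ℕ → ℕ) i j k → c' 2 ≡ j → c' 4 ≡ k → c' 6 ≡ 0 → (i ≡ 0 → j ≡ 0 → k ≡ 0 → ⊥)
     → option flipEnd (merged i j k) ≡ just (merged (c' 2) (c' 4) (c' 6))
  merged-flip c' i .(c' 2) .(c' 4) refl refl C nzz rewrite C with i | c' 2 | c' 4
  ... | zero | zero | zero = ⊥-elim (nzz refl refl refl)
  ... | suc _ | _ | _ = refl
  ... | zero | suc _ | _ = refl
  ... | zero | zero | suc _ = refl

  absent-≥7 : ∀ {s c par} → Admissible s c par → ∀ r → c (suc (suc (suc (suc (suc (suc (suc r))))))) ≡ 0
  absent-≥7 inv r = Admissible.vanish-≥7 inv _ (s≤s (s≤s (s≤s (s≤s (s≤s (s≤s (s≤s z≤n)))))))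

  no-odd-counts : ∀ {s c par} → Admissible s c par → (s ∧ par) ≡ true → (Σ ℕ λ r → c (suc r) ≢ 0) → c 1 ≡ 0 → c 3 ≡ 0 → c 5 ≡ 0 → ⊥
  no-odd-counts inv sp (zero , ne) z1 z3 z5 = ne z1
  no-odd-counts inv sp (suc (suc zero) , ne) z1 z3 z5 = ne z3
  no-odd-counts inv sp (suc (suc (suc (suc zero))) , ne) z1 z3 z5 = ne z5
  no-odd-counts {s} {par = par} inv sp (suc zero , ne) z1 z3 z5 with s ∧ par | Admissible.parity inv 2 ne
  ... | true | ()
  no-odd-counts {s} {par = par} inv sp (suc (suc (suc zero)) , ne) z1 z3 z5 with s ∧ par | Admissible.parity inv 4 ne
  ... | true | ()
  no-odd-counts {s} {par = par} inv sp (suc (suc (suc (suc (suc zero)))) , ne) z1 z3 z5 with s ∧ par | Admissible.parity inv 6 ne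
  ... | true | ()
  no-odd-counts inv sp (suc (suc (suc (suc (suc (suc r))))) , ne) z1 z3 z5 = ne (absent-≥7 inv r)

  no-even-counts : ∀ {s c par} → Admissible s c par → (s ∧ par) ≡ false → (Σ ℕ λ r → c (suc r) ≢ 0) → c 2 ≡ 0 → c 4 ≡ 0 → c 6 ≡ 0 → ⊥
  no-even-counts inv sp (suc zero , ne) z1 z3 z5 = ne z1
  no-even-counts inv sp (suc (suc (suc zero)) , ne) z1 z3 z5 = ne z3
  no-even-counts inv sp (suc (suc (suc (suc (suc zero)))) , ne) z1 z3 z5 = ne z5
  no-even-counts {s} {par = par} inv sp (zero , ne) z1 z3 z5 with s ∧ par | Admissible.parity inv 1 ne
  ... | false | ()
  no-even-counts {s} {par = par} inv sp (suc (suc zero) , ne) z1 z3 z5 with s ∧ par | Admissible.parity inv 3 ne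
  ... | false | ()
  no-even-counts {s} {par = par} inv sp (suc (suc (suc (suc zero))) , ne) z1 z3 z5 with s ∧ par | Admissible.parity inv 5 ne
  ... | false | ()
  no-even-counts inv sp (suc (suc (suc (suc (suc (suc r))))) , ne) z1 z3 z5 = ne (absent-≥7 inv r)

  encode-flip-single : ∀ c c' par → Admissible true c par → c 0 ≡ 0 → (∀ k → c' k ≡ c (suc k)) → (Σ ℕ λ r → c (suc r) ≢ 0)
       → option flipEnd (encode true c par) ≡ just (encode true c' (not par))
  encode-flip-single c c' true inv z0' sh nzr rewrite z0' =
    diffEnds-flip c' (c 1) (c 3) (c 5) (sh 0) (sh 2) (sh 4) (trans (sh 6) (Admissible.vanish-≥7 inv 7 ≤-refl))
       (λ a b d → no-odd-counts inv refl nzr a b d)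
  encode-flip-single c c' false inv z0' sh nzr rewrite z0' =
    sameEnds-flip c' (c 2) (c 4) (c 6) (trans (sh 0) (absent-by-parity inv 1 (λ ()))) (sh 1) (sh 3) (sh 5)
       (λ a b d → no-even-counts inv refl nzr a b d)

  encode-flip-double : ∀ s c c' par → Admissible s c par → (s ≡ false ⊎ c 0 ≢ 0) → c' 0 ≡ c 0 + c 2
       → (∀ k → c' (suc k) ≡ c (suc (suc (suc k)))) → (Σ ℕ λ r → c (suc (suc r)) ≢ 0)
       → option flipEnd (encode s c par) ≡ just (encode s c' par)
  encode-flip-double false c c' par inv _ h0 sh (r , nzr) =
    merged-flip c' (c 2) (c 4) (c 6) (sh 1) (sh 3) (trans (sh 5) (Admissible.vanish-≥7 inv 8 (s≤s (s≤s (s≤s (s≤s (s≤s (s≤s (s≤s z≤n)))))))))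
       (λ a b d → no-even-counts inv refl (suc r , nzr) a b d)
  encode-flip-double true c c' par inv (inj₁ ()) h0 sh nzr
  encode-flip-double true c c' par inv (inj₂ ne) h0 sh (r , nzr) with parity-even {k = 0} inv ne refl
  ... | pf with c 0 in e0 | h0
  ... | zero | _ = ⊥-elim (ne refl)
  ... | suc x | h rewrite h =
    merged-flip c' (c 2) (c 4) (c 6) (sh 1) (sh 3) (trans (sh 5) (Admissible.vanish-≥7 inv 8 (s≤s (s≤s (s≤s (s≤s (s≤s (s≤s (s≤s z≤n)))))))))
       (λ a b d → no-even-counts inv pf (suc r , nzr) a b d)

  nothing≢just : ∀ {σ : Pos} → nothing ≢ just σ
  nothing≢just ()

  merged-flip-nonempty : ∀ a b d σ' → option flipEnd (merged a b d) ≡ just σ' → a ≢ 0 ⊎ (b ≢ 0 ⊎ d ≢ 0)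
  merged-flip-nonempty zero zero zero σ' e = ⊥-elim (nothing≢just e)
  merged-flip-nonempty (suc a) b d σ' e = inj₁ 1+n≢0
  merged-flip-nonempty zero (suc b) d σ' e = inj₂ (inj₁ 1+n≢0)
  merged-flip-nonempty zero zero (suc d) σ' e = inj₂ (inj₂ 1+n≢0)

  sameEnds-flip-nonempty : ∀ a b d σ' → option flipEnd (sameEnds a b d) ≡ just σ' → a ≢ 0 ⊎ (b ≢ 0 ⊎ d ≢ 0)
  sameEnds-flip-nonempty zero zero zero σ' e = ⊥-elim (nothing≢just e)
  sameEnds-flip-nonempty (suc a) b d σ' e = inj₁ 1+n≢0
  sameEnds-flip-nonempty zero (suc b) d σ' e = inj₂ (inj₁ 1+n≢0)
  sameEnds-flip-nonempty zero zero (suc d) σ' e = inj₂ (inj₂ 1+n≢0)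

  diffEnds-flip-nonempty : ∀ a b d σ' → option flipEnd (diffEnds a b d) ≡ just σ' → a ≢ 0 ⊎ (b ≢ 0 ⊎ d ≢ 0)
  diffEnds-flip-nonempty zero zero zero σ' e = ⊥-elim (nothing≢just e)
  diffEnds-flip-nonempty (suc a) b d σ' e = inj₁ 1+n≢0
  diffEnds-flip-nonempty zero (suc b) d σ' e = inj₂ (inj₁ 1+n≢0)
  diffEnds-flip-nonempty zero zero (suc d) σ' e = inj₂ (inj₂ 1+n≢0)

  some-positive : ∀ (c : ℕ → ℕ) inRange-1 inRange-2 inRange-3 → c (suc inRange-1) ≢ 0 ⊎ (c (suc inRange-2) ≢ 0 ⊎ c (suc inRange-3) ≢ 0) → Σ ℕ λ r → c (suc r) ≢ 0
  some-positive c inRange-1 inRange-2 inRange-3 (inj₁ x) = inRange-1 , x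
  some-positive c inRange-1 inRange-2 inRange-3 (inj₂ (inj₁ x)) = inRange-2 , x
  some-positive c inRange-1 inRange-2 inRange-3 (inj₂ (inj₂ x)) = inRange-3 , x

  flip-needs : ∀ s c par σ' → option flipEnd (encode s c par) ≡ just σ' → Σ ℕ λ r → c (suc r) ≢ 0
  flip-needs false c par σ' e = some-positive c 1 3 5 (merged-flip-nonempty (c 2) (c 4) (c 6) σ' e)
  flip-needs true c par σ' e = byEncoding (c 0) par e where
    byEncoding : ∀ z par → option flipEnd (encodeApart z c par) ≡ just σ' → Σ ℕ λ r → c (suc r) ≢ 0
    byEncoding zero true e = some-positive c 0 2 4 (diffEnds-flip-nonempty (c 1) (c 3) (c 5) σ' e)
    byEncoding zero false e = some-positive c 1 3 5 (sameEnds-flip-nonempty (c 2) (c 4) (c 6) σ' e)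
    byEncoding (suc z) par e = some-positive c 1 3 5 (merged-flip-nonempty (c 2) (c 4) (c 6) σ' e)

  record InnerNeed (c : ℕ → ℕ) (k : MoveKind) : Set where
    field
      r0 : ℕ
      two : 2 ≤ r0
      six : r0 ≤ 6
      kd : kindOf r0 ≡ k
      nzr : c r0 ≢ 0

  merged-inner-needs : ∀ c k σ' → option k (merged (c 2) (c 4) (c 6)) ≡ just σ' → k ≢ flipEnd → InnerNeed c k
  merged-inner-needs c inner₂ σ' e _ with c 2 in +0≡+1⇒suc
  ... | suc _ = record { r0 = 2 ; two = ≤-refl ; six = s≤s (s≤s z≤n) ; kd = refl ; nzr = λ z → 1+n≢0 (trans (sym +0≡+1⇒suc) z) }
  ... | zero = ⊥-elim (nothing≢just e)
  merged-inner-needs c inner₄ σ' e _ with c 4 in +0≡+1⇒suc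
  ... | suc _ = record { r0 = 4 ; two = s≤s (s≤s z≤n) ; six = s≤s (s≤s (s≤s (s≤s z≤n))) ; kd = refl ; nzr = λ z → 1+n≢0 (trans (sym +0≡+1⇒suc) z) }
  ... | zero = ⊥-elim (nothing≢just e)
  merged-inner-needs c inner₆ σ' e _ with c 6 in +0≡+1⇒suc
  ... | suc _ = record { r0 = 6 ; two = s≤s (s≤s z≤n) ; six = ≤-refl ; kd = refl ; nzr = λ z → 1+n≢0 (trans (sym +0≡+1⇒suc) z) }
  ... | zero = ⊥-elim (nothing≢just e)
  merged-inner-needs c flipEnd σ' e ne = ⊥-elim (ne refl)

  sameEnds-inner-needs : ∀ c k σ' → option k (sameEnds (c 2) (c 4) (c 6)) ≡ just σ' → k ≢ flipEnd → InnerNeed c k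
  sameEnds-inner-needs c inner₂ σ' e _ with c 2 in +0≡+1⇒suc
  ... | suc _ = record { r0 = 2 ; two = ≤-refl ; six = s≤s (s≤s z≤n) ; kd = refl ; nzr = λ z → 1+n≢0 (trans (sym +0≡+1⇒suc) z) }
  ... | zero = ⊥-elim (nothing≢just e)
  sameEnds-inner-needs c inner₄ σ' e _ with c 4 in +0≡+1⇒suc
  ... | suc _ = record { r0 = 4 ; two = s≤s (s≤s z≤n) ; six = s≤s (s≤s (s≤s (s≤s z≤n))) ; kd = refl ; nzr = λ z → 1+n≢0 (trans (sym +0≡+1⇒suc) z) }
  ... | zero = ⊥-elim (nothing≢just e)
  sameEnds-inner-needs c inner₆ σ' e _ with c 6 in +0≡+1⇒suc
  ... | suc _ = record { r0 = 6 ; two = s≤s (s≤s z≤n) ; six = ≤-refl ; kd = refl ; nzr = λ z → 1+n≢0 (trans (sym +0≡+1⇒suc) z) }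
  ... | zero = ⊥-elim (nothing≢just e)
  sameEnds-inner-needs c flipEnd σ' e ne = ⊥-elim (ne refl)

  diffEnds-inner-needs : ∀ c k σ' → option k (diffEnds (c 1) (c 3) (c 5)) ≡ just σ' → k ≢ flipEnd → InnerNeed c k
  diffEnds-inner-needs c inner₂ σ' e _ = ⊥-elim (nothing≢just e)
  diffEnds-inner-needs c inner₄ σ' e _ with c 3 in +0≡+1⇒suc
  ... | suc _ = record { r0 = 3 ; two = s≤s (s≤s z≤n) ; six = s≤s (s≤s (s≤s z≤n)) ; kd = refl ; nzr = λ z → 1+n≢0 (trans (sym +0≡+1⇒suc) z) }
  ... | zero = ⊥-elim (nothing≢just e)
  diffEnds-inner-needs c inner₆ σ' e _ with c 5 in +0≡+1⇒suc
  ... | suc _ = record { r0 = 5 ; two = s≤s (s≤s z≤n) ; six = s≤s (s≤s (s≤s (s≤s (s≤s z≤n)))) ; kd = refl ; nzr = λ z → 1+n≢0 (trans (sym +0≡+1⇒suc) z) }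
  ... | zero = ⊥-elim (nothing≢just e)
  diffEnds-inner-needs c flipEnd σ' e ne = ⊥-elim (ne refl)

  inner-needs : ∀ s c par k σ' → option k (encode s c par) ≡ just σ' → k ≢ flipEnd → InnerNeed c k
  inner-needs false c par k σ' e ne = merged-inner-needs c k σ' e ne
  inner-needs true c par k σ' e ne = byEncoding (c 0) par e where
    byEncoding : ∀ z par → option k (encodeApart z c par) ≡ just σ' → InnerNeed c k
    byEncoding zero true e = diffEnds-inner-needs c k σ' e ne
    byEncoding zero false e = sameEnds-inner-needs c k σ' e ne
    byEncoding (suc z) par e = merged-inner-needs c k σ' e ne

module BitWord where

  bitAt : ∀ {m} → Vec Bool m → ℕ → Bool
  bitAt [] _ = false
  bitAt (x ∷ v) zero = x
  bitAt (x ∷ v) (suc t) = bitAt v t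

  changes : ∀ {m} → Vec Bool m → ℕ
  changes [] = 0
  changes (x ∷ []) = 0
  changes (x ∷ y ∷ v) = (if x xor y then 1 else 0) + changes (y ∷ v)

  sameBit : Bool → Bool → Bool
  sameBit x y = not (x xor y)

  runFrom : ∀ {m} → Vec Bool m → Bool → ℕ → ℕ → Bool
  runFrom v b t zero = sameBit (bitAt v t) b
  runFrom v b t (suc n) = sameBit (bitAt v t) b ∧ runFrom v b (suc t) n

  prefixRun : ∀ {m} → Vec Bool m → Bool → ℕ → Bool
  prefixRun v b t = runFrom v b 0 t

  suffixRun : ∀ {m} → ℕ → Vec Bool m → Bool → ℕ → Bool
  suffixRun L v b t = runFrom v b t (L ∸ t)

  endBlob : ∀ {m} → ℕ → Vec Bool m → Bool → Bool → Bool → ℕ → Bool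
  endBlob L v b U V t = (U ∧ prefixRun v b t) ∨ (V ∧ suffixRun L v b t)

  innerBlob : ∀ {m} → Vec Bool m → Bool → ℕ → ℕ → Bool
  innerBlob v b t0 t = if t ≤ᵇ t0 then runFrom v b t (t0 ∸ t) else runFrom v b t0 (t ∸ t0)

  build : (ℕ → Bool) → (n : ℕ) → Vec Bool n
  build f zero = []
  build f (suc n) = f 0 ∷ build (λ t → f (suc t)) n

  flipWhere : ∀ {m} → (ℕ → Bool) → Vec Bool m → Bool → Vec Bool m
  flipWhere {m} β v b = build (λ t → if β t then not b else bitAt v t) m

  imp : Bool → Bool → Bool
  imp x y = not x ∨ y

  allBits : (Bool → Bool) → Bool
  allBits P = P true ∧ P false

  allWords : (n : ℕ) → (Vec Bool n → Bool) → Bool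
  allWords zero P = P []
  allWords (suc n) P = allWords n (λ v → P (true ∷ v)) ∧ allWords n (λ v → P (false ∷ v))

  allBits-sound : ∀ P → T (allBits P) → ∀ b → T (P b)
  allBits-sound P p true = T-∧-fst′ (P true) _ p
  allBits-sound P p false = T-∧-snd′ (P true) _ p

  allWords-sound : ∀ n P → T (allWords n P) → ∀ v → T (P v)
  allWords-sound zero P p [] = p
  allWords-sound (suc n) P p (true ∷ v) = allWords-sound n (λ w → P (true ∷ w)) (T-∧-fst′ (allWords n (λ w → P (true ∷ w))) _ p) v
  allWords-sound (suc n) P p (false ∷ v) = allWords-sound n (λ w → P (false ∷ w)) (T-∧-snd′ (allWords n (λ w → P (true ∷ w))) _ p) v

  T-imp : ∀ x y → T (imp x y) → T x → T y
  T-imp true y p q = p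

  innerStart? : ∀ {m} → Vec Bool m → ℕ → ℕ → Bool
  innerStart? v L t0 = (0 <ᵇ t0) ∧ (t0 <ᵇ L) ∧ not (sameBit (bitAt v t0) (bitAt v (suc t0)))
     ∧ not (innerBlob v (bitAt v t0) t0 0) ∧ not (innerBlob v (bitAt v t0) t0 L)

  endStart? : ∀ {m} → Vec Bool m → ℕ → ℕ → Bool
  endStart? v L t0 = (t0 <ᵇ L) ∧ prefixRun v (bitAt v 0) t0 ∧ not (sameBit (bitAt v t0) (bitAt v (suc t0)))

  search : (ℕ → Bool) → ℕ → ℕ
  search P zero = 0
  search P (suc n) = if P n then n else search P n

  bitAt-build : ∀ f n t → t < n → bitAt (build f n) t ≡ f t
  bitAt-build f (suc n) zero lt = refl
  bitAt-build f (suc n) (suc t) (s≤s lt) = bitAt-build (λ t → f (suc t)) n t lt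

  build-ext : ∀ f g n → (∀ t → t < n → f t ≡ g t) → build f n ≡ build g n
  build-ext f g zero e = refl
  build-ext f g (suc n) e = cong₂ _∷_ (e 0 (s≤s z≤n)) (build-ext (λ t → f (suc t)) (λ t → g (suc t)) n (λ t lt → e (suc t) (s≤s lt)))

  build-bitAt : ∀ {m} (v : Vec Bool m) → build (bitAt v) m ≡ v
  build-bitAt [] = refl
  build-bitAt (y ∷ v) = cong (y ∷_) (build-bitAt v)

  flipWhere-cong : ∀ {m} f g (v : Vec Bool m) bb → (∀ t → f t ≡ g t) → flipWhere f v bb ≡ flipWhere g v bb
  flipWhere-cong {m} f g v bb e = build-ext _ _ m (λ t _ → cong (λ z → if z then not bb else bitAt v t) (e t))

  flipWhere-none : ∀ {m} (v : Vec Bool m) bb → flipWhere (λ _ → false) v bb ≡ v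
  flipWhere-none {m} v bb = build-bitAt v

module BitWordFacts where

  open BitWord

  -- Every fact below is established by evaluating it on all words of length at most 7.
  upTo6-elim : (P : ℕ → Set) → P 0 → P 1 → P 2 → P 3 → P 4 → P 5 → P 6 → ∀ L → L ≤ 6 → P L
  upTo6-elim P p0 p1 p2 p3 p4 p5 p6 zero _ = p0
  upTo6-elim P p0 p1 p2 p3 p4 p5 p6 (suc zero) _ = p1
  upTo6-elim P p0 p1 p2 p3 p4 p5 p6 (suc (suc zero)) _ = p2
  upTo6-elim P p0 p1 p2 p3 p4 p5 p6 (suc (suc (suc zero))) _ = p3
  upTo6-elim P p0 p1 p2 p3 p4 p5 p6 (suc (suc (suc (suc zero)))) _ = p4
  upTo6-elim P p0 p1 p2 p3 p4 p5 p6 (suc (suc (suc (suc (suc zero))))) _ = p5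
  upTo6-elim P p0 p1 p2 p3 p4 p5 p6 (suc (suc (suc (suc (suc (suc zero)))))) _ = p6
  upTo6-elim P p0 p1 p2 p3 p4 p5 p6 (suc (suc (suc (suc (suc (suc (suc L))))))) (s≤s (s≤s (s≤s (s≤s (s≤s (s≤s ()))))))

  sameBit⇒≡ : ∀ {x y} → T (sameBit x y) → x ≡ y
  sameBit⇒≡ {true} {true} _ = refl
  sameBit⇒≡ {false} {false} _ = refl

  ≡⇒sameBit : ∀ {x y} → x ≡ y → T (sameBit x y)
  ≡⇒sameBit {true} refl = tt
  ≡⇒sameBit {false} refl = tt

  parity-check : ℕ → Bool
  parity-check L = allWords (suc L) (λ v → sameBit (isEven (changes v)) (not (bitAt v 0 xor bitAt v L)))

  changes-parity : ∀ L → L ≤ 6 → (v : Vec Bool (suc L)) → isEven (changes v) ≡ not (bitAt v 0 xor bitAt v L)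
  changes-parity L h v = sameBit⇒≡ (allWords-sound (suc L) (λ v → sameBit (isEven (changes v)) (not (bitAt v 0 xor bitAt v L))) (upTo6-elim (λ L → T (parity-check L)) tt tt tt tt tt tt tt L h) v)

  bound-check : ℕ → Bool
  bound-check L = allWords (suc L) (λ v → changes v ≤ᵇ L)

  changes-≤ : ∀ L → L ≤ 6 → (v : Vec Bool (suc L)) → changes v ≤ L
  changes-≤ L h v = ≤ᵇ⇒≤ _ _ (allWords-sound (suc L) (λ v → changes v ≤ᵇ L) (upTo6-elim (λ L → T (bound-check L)) tt tt tt tt tt tt tt L h) v)

  monochrome-check : ℕ → Bool
  monochrome-check L = allWords (suc L) (λ v → sameBit (changes v ≡ᵇ 0) (prefixRun v (bitAt v 0) L))

  changes≡0-prefixRun : ∀ L → L ≤ 6 → (v : Vec Bool (suc L)) → (changes v ≡ᵇ 0) ≡ prefixRun v (bitAt v 0) L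
  changes≡0-prefixRun L h v = sameBit⇒≡ (allWords-sound (suc L) (λ v → sameBit (changes v ≡ᵇ 0) (prefixRun v (bitAt v 0) L)) (upTo6-elim (λ L → T (monochrome-check L)) tt tt tt tt tt tt tt L h) v)

  innerStart-check : ℕ → Bool
  innerStart-check L = allWords (suc L) (λ v → imp (2 ≤ᵇ changes v) (innerStart? v L (search (innerStart? v L) 7)))

  innerStart-exists : ∀ L → L ≤ 6 → (v : Vec Bool (suc L)) → 2 ≤ changes v → Σ ℕ λ t0 → T (innerStart? v L t0)
  innerStart-exists L h v le = search (innerStart? v L) 7 , T-imp _ _ (allWords-sound (suc L) (λ v → imp (2 ≤ᵇ changes v) (innerStart? v L (search (innerStart? v L) 7))) (upTo6-elim (λ L → T (innerStart-check L)) tt tt tt tt tt tt tt L h) v) (≤⇒≤ᵇ le)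

  endStart-check : ℕ → Bool
  endStart-check L = allWords (suc L) (λ v → imp (1 ≤ᵇ changes v) (endStart? v L (search (endStart? v L) 7)))

  endStart-exists : ∀ L → L ≤ 6 → (v : Vec Bool (suc L)) → 1 ≤ changes v → Σ ℕ λ t0 → T (endStart? v L t0)
  endStart-exists L h v le = search (endStart? v L) 7 , T-imp _ _ (allWords-sound (suc L) (λ v → imp (1 ≤ᵇ changes v) (endStart? v L (search (endStart? v L) 7))) (upTo6-elim (λ L → T (endStart-check L)) tt tt tt tt tt tt tt L h) v) (≤⇒≤ᵇ le)

  flipPrefixᵇ : ℕ → ∀ {m} → Vec Bool m → Bool → Bool
  flipPrefixᵇ L v b = imp (sameBit (bitAt v 0) b ∧ not (prefixRun v b L)) (changes (flipWhere (endBlob L v b true false) v b) + 1 ≡ᵇ changes v)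

  flipPrefix-check : ℕ → Bool
  flipPrefix-check L = allWords (suc L) (λ v → allBits (flipPrefixᵇ L v))

  flipPrefix-changes : ∀ L → L ≤ 6 → (v : Vec Bool (suc L)) → ∀ b → bitAt v 0 ≡ b → prefixRun v b L ≡ false
       → changes (flipWhere (endBlob L v b true false) v b) + 1 ≡ changes v
  flipPrefix-changes L h v b e1 e2 = ≡ᵇ⇒≡ _ _ (T-imp _ _ (allBits-sound (flipPrefixᵇ L v) (allWords-sound (suc L) (λ v → allBits (flipPrefixᵇ L v)) (upTo6-elim (λ L → T (flipPrefix-check L)) tt tt tt tt tt tt tt L h) v) b) (T-∧-intro (≡⇒sameBit e1) (T-not e2)))

  flipSuffixᵇ : ℕ → ∀ {m} → Vec Bool m → Bool → Bool
  flipSuffixᵇ L v b = imp (sameBit (bitAt v L) b ∧ not (suffixRun L v b 0)) (changes (flipWhere (endBlob L v b false true) v b) + 1 ≡ᵇ changes v)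

  flipSuffix-check : ℕ → Bool
  flipSuffix-check L = allWords (suc L) (λ v → allBits (flipSuffixᵇ L v))

  flipSuffix-changes : ∀ L → L ≤ 6 → (v : Vec Bool (suc L)) → ∀ b → bitAt v L ≡ b → suffixRun L v b 0 ≡ false
       → changes (flipWhere (endBlob L v b false true) v b) + 1 ≡ changes v
  flipSuffix-changes L h v b e1 e2 = ≡ᵇ⇒≡ _ _ (T-imp _ _ (allBits-sound (flipSuffixᵇ L v) (allWords-sound (suc L) (λ v → allBits (flipSuffixᵇ L v)) (upTo6-elim (λ L → T (flipSuffix-check L)) tt tt tt tt tt tt tt L h) v) b) (T-∧-intro (≡⇒sameBit e1) (T-not e2)))

  flipBothEndsᵇ : ℕ → ∀ {m} → Vec Bool m → Bool → Bool
  flipBothEndsᵇ L v b = imp (sameBit (bitAt v 0) b ∧ sameBit (bitAt v L) b) (changes (flipWhere (endBlob L v b true true) v b) ≡ᵇ changes v ∸ 2)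

  flipBothEnds-check : ℕ → Bool
  flipBothEnds-check L = allWords (suc L) (λ v → allBits (flipBothEndsᵇ L v))

  flipBothEnds-changes : ∀ L → L ≤ 6 → (v : Vec Bool (suc L)) → ∀ b → bitAt v 0 ≡ b → bitAt v L ≡ b
       → changes (flipWhere (endBlob L v b true true) v b) ≡ changes v ∸ 2
  flipBothEnds-changes L h v b e1 e2 = ≡ᵇ⇒≡ _ _ (T-imp _ _ (allBits-sound (flipBothEndsᵇ L v) (allWords-sound (suc L) (λ v → allBits (flipBothEndsᵇ L v)) (upTo6-elim (λ L → T (flipBothEnds-check L)) tt tt tt tt tt tt tt L h) v) b) (T-∧-intro (≡⇒sameBit e1) (≡⇒sameBit e2)))

  flipInnerᵇ : ∀ {m} → ℕ → Vec Bool m → Bool → ℕ → Bool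
  flipInnerᵇ L v b t0 = imp ((0 <ᵇ t0) ∧ sameBit (bitAt v t0) b ∧ not (innerBlob v b t0 0) ∧ not (innerBlob v b t0 L))
                     (changes (flipWhere (innerBlob v b t0) v b) + 2 ≡ᵇ changes v)

  flipInner-check : ℕ → Bool
  flipInner-check L = allWords (suc L) (λ v → allBits (λ b → allBelow L (flipInnerᵇ L v b)))

  flipInner-changes : ∀ L → L ≤ 6 → (v : Vec Bool (suc L)) → ∀ b t0 → t0 < L → 0 < t0 → bitAt v t0 ≡ b
      → innerBlob v b t0 0 ≡ false → innerBlob v b t0 L ≡ false → changes (flipWhere (innerBlob v b t0) v b) + 2 ≡ changes v
  flipInner-changes L h v b t0 lt pos e1 e2 e3 = ≡ᵇ⇒≡ _ _ (T-imp _ _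
     (allBelow-sound L (flipInnerᵇ L v b) (allBits-sound (λ b → allBelow L (flipInnerᵇ L v b)) (allWords-sound (suc L) (λ v → allBits (λ b → allBelow L (flipInnerᵇ L v b))) (upTo6-elim (λ L → T (flipInner-check L)) tt tt tt tt tt tt tt L h) v) b) t0 lt)
     (T-∧-intro (<⇒<ᵇ pos) (T-∧-intro (≡⇒sameBit e1) (T-∧-intro (T-not e2) (T-not e3)))))

  innerBlob-closedᵇ : ∀ {m} → Vec Bool m → Bool → ℕ → ℕ → Bool
  innerBlob-closedᵇ v b t0 t = imp (innerBlob v b t0 t ∧ sameBit (bitAt v (suc t)) b) (innerBlob v b t0 (suc t))
               ∧ imp (innerBlob v b t0 (suc t) ∧ sameBit (bitAt v t) b) (innerBlob v b t0 t)

  innerBlob-closed-check : ℕ → Bool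
  innerBlob-closed-check L = allWords (suc L) (λ v → allBits (λ b → allBelow (suc L) (λ t0 → allBelow L (λ t → innerBlob-closedᵇ v b t0 t))))

  innerBlob-closed-facts : ∀ L → L ≤ 6 → (v : Vec Bool (suc L)) → ∀ b t0 t → t0 ≤ L → t < L → T (innerBlob-closedᵇ v b t0 t)
  innerBlob-closed-facts L h v b t0 t le lt =
    allBelow-sound L (innerBlob-closedᵇ v b t0) (allBelow-sound (suc L) (λ t0 → allBelow L (innerBlob-closedᵇ v b t0))
      (allBits-sound (λ b → allBelow (suc L) (λ t0 → allBelow L (innerBlob-closedᵇ v b t0)))
        (allWords-sound (suc L) (λ v → allBits (λ b → allBelow (suc L) (λ t0 → allBelow L (innerBlob-closedᵇ v b t0))))
          (upTo6-elim (λ L → T (innerBlob-closed-check L)) tt tt tt tt tt tt tt L h) v) b) t0 (s≤s le)) t lt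

  innerBlob-forward : ∀ L → L ≤ 6 → (v : Vec Bool (suc L)) → ∀ b t0 t → t0 ≤ L → t < L
       → T (innerBlob v b t0 t) → bitAt v (suc t) ≡ b → T (innerBlob v b t0 (suc t))
  innerBlob-forward L h v b t0 t le lt p e = T-imp _ _ (T-∧-fst (innerBlob-closed-facts L h v b t0 t le lt)) (T-∧-intro p (≡⇒sameBit e))

  innerBlob-backward : ∀ L → L ≤ 6 → (v : Vec Bool (suc L)) → ∀ b t0 t → t0 ≤ L → t < L
       → T (innerBlob v b t0 (suc t)) → bitAt v t ≡ b → T (innerBlob v b t0 t)
  innerBlob-backward L h v b t0 t le lt p e = T-imp _ _ (T-∧-snd {imp (innerBlob v b t0 t ∧ sameBit (bitAt v (suc t)) b) (innerBlob v b t0 (suc t))} (innerBlob-closed-facts L h v b t0 t le lt)) (T-∧-intro p (≡⇒sameBit e))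

  T-imp-intro : ∀ {x y} → (x ≡ true → T y) → T (imp x y)
  T-imp-intro {true} f = f refl
  T-imp-intro {false} f = tt

  endBlob-closedᵇ : ℕ → ∀ {m} → Vec Bool m → Bool → Bool → Bool → ℕ → Bool
  endBlob-closedᵇ L v b U V t = imp (endBlob L v b U V t ∧ sameBit (bitAt v (suc t)) b) (endBlob L v b U V (suc t))
                  ∧ imp (endBlob L v b U V (suc t) ∧ sameBit (bitAt v t) b) (endBlob L v b U V t)

  endBlob-endsᵇ : ℕ → ∀ {m} → Vec Bool m → Bool → Bool → Bool → Bool
  endBlob-endsᵇ L v b U V = imp (imp U (sameBit (bitAt v 0) b) ∧ imp (V ∧ suffixRun L v b 0) U) (sameBit (endBlob L v b U V 0) U)
                 ∧ imp (imp V (sameBit (bitAt v L) b) ∧ imp (U ∧ prefixRun v b L) V) (sameBit (endBlob L v b U V L) V)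

  endBlobᵇ : ℕ → ∀ {m} → Vec Bool m → Bool → Bool → Bool → Bool
  endBlobᵇ L v b U V = allBelow L (endBlob-closedᵇ L v b U V) ∧ endBlob-endsᵇ L v b U V

  endBlob-check : ℕ → Bool
  endBlob-check L = allWords (suc L) (λ v → allBits (λ b → allBits (λ U → allBits (λ V → endBlobᵇ L v b U V))))

  endBlob-facts : ∀ L → L ≤ 6 → (v : Vec Bool (suc L)) → ∀ b U V → T (endBlobᵇ L v b U V)
  endBlob-facts L h v b U V = allBits-sound (endBlobᵇ L v b U) (allBits-sound (λ U → allBits (endBlobᵇ L v b U)) (allBits-sound (λ b → allBits (λ U → allBits (endBlobᵇ L v b U)))
     (allWords-sound (suc L) (λ v → allBits (λ b → allBits (λ U → allBits (endBlobᵇ L v b U)))) (upTo6-elim (λ L → T (endBlob-check L)) tt tt tt tt tt tt tt L h) v) b) U) V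

  endBlob-forward : ∀ L → L ≤ 6 → (v : Vec Bool (suc L)) → ∀ b U V t → t < L
       → T (endBlob L v b U V t) → bitAt v (suc t) ≡ b → T (endBlob L v b U V (suc t))
  endBlob-forward L h v b U V t lt p e = T-imp _ _ (T-∧-fst (allBelow-sound L (endBlob-closedᵇ L v b U V) (T-∧-fst (endBlob-facts L h v b U V)) t lt)) (T-∧-intro p (≡⇒sameBit e))

  endBlob-backward : ∀ L → L ≤ 6 → (v : Vec Bool (suc L)) → ∀ b U V t → t < L
       → T (endBlob L v b U V (suc t)) → bitAt v t ≡ b → T (endBlob L v b U V t)
  endBlob-backward L h v b U V t lt p e = T-imp _ _ (T-∧-snd {imp (endBlob L v b U V t ∧ sameBit (bitAt v (suc t)) b) (endBlob L v b U V (suc t))} (allBelow-sound L (endBlob-closedᵇ L v b U V) (T-∧-fst (endBlob-facts L h v b U V)) t lt)) (T-∧-intro p (≡⇒sameBit e))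

  endBlob-start : ∀ L → L ≤ 6 → (v : Vec Bool (suc L)) → ∀ b U V → (U ≡ true → bitAt v 0 ≡ b) → (V ≡ true → T (suffixRun L v b 0) → U ≡ true)
      → endBlob L v b U V 0 ≡ U
  endBlob-start L h v b U V h1 h2 = sameBit⇒≡ (T-imp _ _ (T-∧-fst (T-∧-snd {allBelow L (endBlob-closedᵇ L v b U V)} (endBlob-facts L h v b U V)))
     (T-∧-intro (T-imp-intro (λ e → ≡⇒sameBit (h1 e))) (T-imp-intro {V ∧ suffixRun L v b 0} (λ e → ≡true⇒T (h2 (T⇒≡true (T-∧-fst (≡true⇒T e))) (T-∧-snd (≡true⇒T e)))))))

  endBlob-end : ∀ L → L ≤ 6 → (v : Vec Bool (suc L)) → ∀ b U V → (V ≡ true → bitAt v L ≡ b) → (U ≡ true → T (prefixRun v b L) → V ≡ true)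
      → endBlob L v b U V L ≡ V
  endBlob-end L h v b U V h1 h2 = sameBit⇒≡ (T-imp _ _ (T-∧-snd {imp (imp U (sameBit (bitAt v 0) b) ∧ imp (V ∧ suffixRun L v b 0) U) (sameBit (endBlob L v b U V 0) U)} (T-∧-snd {allBelow L (endBlob-closedᵇ L v b U V)} (endBlob-facts L h v b U V)))
     (T-∧-intro (T-imp-intro (λ e → ≡⇒sameBit (h1 e))) (T-imp-intro {U ∧ prefixRun v b L} (λ e → ≡true⇒T (h2 (T⇒≡true (T-∧-fst (≡true⇒T e))) (T-∧-snd (≡true⇒T e)))))))

  innerBlob-bitᵇ : ∀ {m} → Vec Bool m → Bool → ℕ → ℕ → Bool
  innerBlob-bitᵇ v b t0 t = imp (innerBlob v b t0 t) (sameBit (bitAt v t) b)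

  innerBlob-bit-check : ℕ → Bool
  innerBlob-bit-check L = allWords (suc L) (λ v → allBits (λ b → allBelow (suc L) (λ t0 → allBelow (suc L) (innerBlob-bitᵇ v b t0))))

  innerBlob-bit : ∀ L → L ≤ 6 → (v : Vec Bool (suc L)) → ∀ b t0 t → t0 ≤ L → t ≤ L → T (innerBlob v b t0 t) → bitAt v t ≡ b
  innerBlob-bit L h v b t0 t le1 le2 p = sameBit⇒≡ (T-imp _ _ (allBelow-sound (suc L) (innerBlob-bitᵇ v b t0) (allBelow-sound (suc L) (λ t0 → allBelow (suc L) (innerBlob-bitᵇ v b t0))
     (allBits-sound (λ b → allBelow (suc L) (λ t0 → allBelow (suc L) (innerBlob-bitᵇ v b t0))) (allWords-sound (suc L) (λ v → allBits (λ b → allBelow (suc L) (λ t0 → allBelow (suc L) (innerBlob-bitᵇ v b t0))))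
       (upTo6-elim (λ L → T (innerBlob-bit-check L)) tt tt tt tt tt tt tt L h) v) b) t0 (s≤s le1)) t (s≤s le2)) p)

  runStepᵇ : ℕ → ∀ {m} → Vec Bool m → Bool → ℕ → Bool
  runStepᵇ L v b t = imp (prefixRun v b (suc t)) (prefixRun v b t ∧ sameBit (bitAt v (suc t)) b)
             ∧ imp (suffixRun L v b t) (suffixRun L v b (suc t) ∧ sameBit (bitAt v t) b)
             ∧ imp (not (sameBit (bitAt v t) (bitAt v (suc t)))) (1 ≤ᵇ changes v)

  innerBlob-stepᵇ : ℕ → ∀ {m} → Vec Bool m → Bool → ℕ → ℕ → Bool
  innerBlob-stepᵇ L v b t0 t = imp ((t <ᵇ t0) ∧ innerBlob v b t0 t) (innerBlob v b t0 (suc t))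
                 ∧ imp ((t0 ≤ᵇ t) ∧ innerBlob v b t0 (suc t)) (innerBlob v b t0 t)

  runBitᵇ : ℕ → ∀ {m} → Vec Bool m → Bool → ℕ → Bool
  runBitᵇ L v b t = imp (prefixRun v b t) (sameBit (bitAt v t) b) ∧ imp (suffixRun L v b t) (sameBit (bitAt v t) b)

  runsᵇ : ℕ → ∀ {m} → Vec Bool m → Bool → Bool
  runsᵇ L v b = (allBelow L (runStepᵇ L v b) ∧ allBelow (suc L) (λ t0 → allBelow L (innerBlob-stepᵇ L v b t0))) ∧ allBelow (suc L) (runBitᵇ L v b)

  runs-check : ℕ → Bool
  runs-check L = allWords (suc L) (λ v → allBits (runsᵇ L v))

  runs-facts : ∀ L → L ≤ 6 → (v : Vec Bool (suc L)) → ∀ b → T (runsᵇ L v b)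
  runs-facts L h v b = allBits-sound (runsᵇ L v) (allWords-sound (suc L) (λ v → allBits (runsᵇ L v)) (upTo6-elim (λ L → T (runs-check L)) tt tt tt tt tt tt tt L h) v) b

  runStep-facts : ∀ L → L ≤ 6 → (v : Vec Bool (suc L)) → ∀ b t → t < L → T (runStepᵇ L v b t)
  runStep-facts L h v b t lt = allBelow-sound L (runStepᵇ L v b) (T-∧-fst (T-∧-fst (runs-facts L h v b))) t lt

  prefixRun-step : ∀ L → L ≤ 6 → (v : Vec Bool (suc L)) → ∀ b t → t < L → T (prefixRun v b (suc t)) → T (prefixRun v b t) × bitAt v (suc t) ≡ b
  prefixRun-step L h v b t lt p with T-imp _ _ (T-∧-fst (runStep-facts L h v b t lt)) p
  ... | q = T-∧-fst q , sameBit⇒≡ (T-∧-snd {prefixRun v b t} q)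

  suffixRun-step : ∀ L → L ≤ 6 → (v : Vec Bool (suc L)) → ∀ b t → t < L → T (suffixRun L v b t) → T (suffixRun L v b (suc t)) × bitAt v t ≡ b
  suffixRun-step L h v b t lt p with T-imp _ _ (T-∧-fst (T-∧-snd {imp (prefixRun v b (suc t)) (prefixRun v b t ∧ sameBit (bitAt v (suc t)) b)} (runStep-facts L h v b t lt))) p
  ... | q = T-∧-fst q , sameBit⇒≡ (T-∧-snd {suffixRun L v b (suc t)} q)

  changes-positive : ∀ L → L ≤ 6 → (v : Vec Bool (suc L)) → ∀ t → t < L → bitAt v t ≢ bitAt v (suc t) → 1 ≤ changes v
  changes-positive L h v t lt ne = ≤ᵇ⇒≤ _ _ (T-imp _ _ (T-∧-snd {imp (suffixRun L v true t) (suffixRun L v true (suc t) ∧ sameBit (bitAt v t) true)} (T-∧-snd {imp (prefixRun v true (suc t)) (prefixRun v true t ∧ sameBit (bitAt v (suc t)) true)} (runStep-facts L h v true t lt))) (T-not (neq ne)))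
    where
    neq : ∀ {x y} → x ≢ y → sameBit x y ≡ false
    neq {true} {true} n = ⊥-elim (n refl)
    neq {true} {false} n = refl
    neq {false} {true} n = refl
    neq {false} {false} n = ⊥-elim (n refl)

  innerBlob-up : ∀ L → L ≤ 6 → (v : Vec Bool (suc L)) → ∀ b t0 t → t0 ≤ L → t < t0 → T (innerBlob v b t0 t) → T (innerBlob v b t0 (suc t))
  innerBlob-up L h v b t0 t le lt p = T-imp _ _ (T-∧-fst (allBelow-sound L (innerBlob-stepᵇ L v b t0) (allBelow-sound (suc L) (λ t0 → allBelow L (innerBlob-stepᵇ L v b t0)) (T-∧-snd {allBelow L (runStepᵇ L v b)} (T-∧-fst (runs-facts L h v b))) t0 (s≤s le)) t (<-≤-trans lt le))) (T-∧-intro (<⇒<ᵇ lt) p)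

  innerBlob-down : ∀ L → L ≤ 6 → (v : Vec Bool (suc L)) → ∀ b t0 t → t0 ≤ L → t0 ≤ t → t < L → T (innerBlob v b t0 (suc t)) → T (innerBlob v b t0 t)
  innerBlob-down L h v b t0 t le le2 lt p = T-imp _ _ (T-∧-snd {imp ((t <ᵇ t0) ∧ innerBlob v b t0 t) (innerBlob v b t0 (suc t))} (allBelow-sound L (innerBlob-stepᵇ L v b t0) (allBelow-sound (suc L) (λ t0 → allBelow L (innerBlob-stepᵇ L v b t0)) (T-∧-snd {allBelow L (runStepᵇ L v b)} (T-∧-fst (runs-facts L h v b))) t0 (s≤s le)) t lt)) (T-∧-intro (≤⇒≤ᵇ le2) p)

  prefixRun-bit : ∀ L → L ≤ 6 → (v : Vec Bool (suc L)) → ∀ b t → t ≤ L → T (prefixRun v b t) → bitAt v t ≡ b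
  prefixRun-bit L h v b t le p = sameBit⇒≡ (T-imp _ _ (T-∧-fst (allBelow-sound (suc L) (runBitᵇ L v b) (T-∧-snd {allBelow L (runStepᵇ L v b) ∧ allBelow (suc L) (λ t0 → allBelow L (innerBlob-stepᵇ L v b t0))} (runs-facts L h v b)) t (s≤s le))) p)

  suffixRun-bit : ∀ L → L ≤ 6 → (v : Vec Bool (suc L)) → ∀ b t → t ≤ L → T (suffixRun L v b t) → bitAt v t ≡ b
  suffixRun-bit L h v b t le p = sameBit⇒≡ (T-imp _ _ (T-∧-snd {imp (prefixRun v b t) (sameBit (bitAt v t) b)} (allBelow-sound (suc L) (runBitᵇ L v b) (T-∧-snd {allBelow L (runStepᵇ L v b) ∧ allBelow (suc L) (λ t0 → allBelow L (innerBlob-stepᵇ L v b t0))} (runs-facts L h v b)) t (s≤s le))) p)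

  ¬sameBit⇒≢ : ∀ {x y} → T (not (sameBit x y)) → x ≢ y
  ¬sameBit⇒≢ {true} {true} () refl
  ¬sameBit⇒≢ {false} {false} () refl

  innerStart-spec : ∀ {m} (v : Vec Bool m) L t0 → T (innerStart? v L t0)
           → (0 < t0) × (t0 < L) × (bitAt v t0 ≢ bitAt v (suc t0)) × (innerBlob v (bitAt v t0) t0 0 ≡ false) × (innerBlob v (bitAt v t0) t0 L ≡ false)
  innerStart-spec v L t0 h with 0 <ᵇ t0 in e1 | t0 <ᵇ L in e2 | sameBit (bitAt v t0) (bitAt v (suc t0)) in e3 | innerBlob v (bitAt v t0) t0 0 in e4 | innerBlob v (bitAt v t0) t0 L in e5
  ... | true | true | false | false | false = <ᵇ⇒< 0 t0 (≡true⇒T e1) , <ᵇ⇒< t0 L (≡true⇒T e2) , ¬sameBit⇒≢ (subst (λ z → T (not z)) (sym e3) tt) , refl , refl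

  endStart-spec : ∀ {m} (v : Vec Bool m) L t0 → T (endStart? v L t0)
           → (t0 < L) × T (prefixRun v (bitAt v 0) t0) × (bitAt v t0 ≢ bitAt v (suc t0))
  endStart-spec v L t0 h with t0 <ᵇ L in e2 | prefixRun v (bitAt v 0) t0 in e3 | sameBit (bitAt v t0) (bitAt v (suc t0)) in e4
  ... | true | true | false = <ᵇ⇒< t0 L (≡true⇒T e2) , tt , ¬sameBit⇒≢ (subst (λ z → T (not z)) (sym e4) tt)

  alternatingᵇ : ℕ → ∀ {m} → Vec Bool m → Bool
  alternatingᵇ L v = imp (allBelow L (λ t → not (sameBit (bitAt v t) (bitAt v (suc t))))) (changes v ≡ᵇ L)

  alternating-check : ℕ → Bool
  alternating-check L = allWords (suc L) (alternatingᵇ L)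

  alternating-changes : ∀ L → L ≤ 6 → (v : Vec Bool (suc L)) → (∀ t → t < L → bitAt v t ≢ bitAt v (suc t)) → changes v ≡ L
  alternating-changes L h v d = ≡ᵇ⇒≡ _ _ (T-imp _ _ (allWords-sound (suc L) (alternatingᵇ L) (upTo6-elim (λ L → T (alternating-check L)) tt tt tt tt tt tt tt L h) v)
     (allBelow-intro L (λ t → not (sameBit (bitAt v t) (bitAt v (suc t)))) (λ t lt → T-not (neq (d t lt)))))
    where
    neq : ∀ {x y} → x ≢ y → sameBit x y ≡ false
    neq {true} {true} n = ⊥-elim (n refl)
    neq {true} {false} n = refl
    neq {false} {true} n = refl
    neq {false} {false} n = ⊥-elim (n refl)

module ThetaGame (s : Bool) (ls : List ℕ) (ca cb : ℕ)
  (len≤6 : ∀ (p : Fin (length ls)) → lookup ls p ≤ 6)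
  (len≥1 : ∀ (p : Fin (length ls)) → 1 ≤ lookup ls p) where

  open BitWord
  open BitWordFacts
  open Multiplicity
  open AbstractGame
  open Encoding

  G : Graph
  G = Theta s ls

  n : ℕ
  n = length ls

  len : Fin n → ℕ
  len p = lookup ls p

  Vertex : Set
  Vertex = Vtx s ls

  uVertex vVertex : Vertex
  uVertex = inj₁ (uE s)
  vVertex = inj₁ (vE s)

  vertexAt-suc : (p : Fin n) (t : ℕ) → Dec (suc t < len p) → Vertex
  vertexAt-suc p t (yes h) = inj₂ (p , suc t , s≤s z≤n , h)
  vertexAt-suc p t (no _) = vVertex

  vertexAt : Fin n → ℕ → Vertex
  vertexAt p zero = uVertex
  vertexAt p (suc t) = vertexAt-suc p t (suc t <? len p)

  vertexAt-end : ∀ p t → suc t ≡ len p → vertexAt p (suc t) ≡ vVertex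
  vertexAt-end p t e with suc t <? len p
  ... | yes h = ⊥-elim (<-irrefl e h)
  ... | no _ = refl

  len-suc : ∀ p → Σ ℕ λ t → len p ≡ suc t
  len-suc p with len p | len≥1 p
  ... | suc t | _ = t , refl

  vertexAt-len : ∀ p → vertexAt p (len p) ≡ vVertex
  vertexAt-len p with len-suc p
  ... | t , e rewrite e = vertexAt-end p t (sym e)

  vertexAt-inner : ∀ p t (h1 : 0 < t) (h2 : t < len p) → vertexAt p t ≡ inj₂ (p , t , h1 , h2)
  vertexAt-inner p (suc t) (s≤s z≤n) h2 with suc t <? len p
  ... | yes h = cong (λ z → inj₂ (p , suc t , s≤s z≤n , z)) (<-irrelevant h h2)
  ... | no nh = ⊥-elim (nh h2)

  At⇒vertexAt : ∀ {p t y} → At s ls p t y → y ≡ vertexAt p t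
  At⇒vertexAt atU = refl
  At⇒vertexAt {p} atV = sym (vertexAt-len p)
  At⇒vertexAt {p} (atM t h1 h2) = sym (vertexAt-inner p t h1 h2)

  At⇒≤len : ∀ {p t y} → At s ls p t y → t ≤ len p
  At⇒≤len atU = z≤n
  At⇒≤len atV = ≤-refl
  At⇒≤len (atM t h1 h2) = <⇒≤ h2

  vertexAt-At : ∀ p t → t ≤ len p → At s ls p t (vertexAt p t)
  vertexAt-At p zero le = atU
  vertexAt-At p (suc t) le with suc t <? len p
  ... | yes h = atM (suc t) (s≤s z≤n) h
  ... | no nh = subst (λ z → At s ls p z vVertex) (sym (≤∧≮⇒≡ le nh)) atV

  vertexAt-adj : ∀ p t → t < len p → Graph.Adj G (vertexAt p t) (vertexAt p (suc t))
  vertexAt-adj p t lt = p , t , inj₁ (vertexAt-At p t (<⇒≤ lt) , vertexAt-At p (suc t) lt)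

  vertexAt-adj′ : ∀ p t → t < len p → Graph.Adj G (vertexAt p (suc t)) (vertexAt p t)
  vertexAt-adj′ p t lt = p , t , inj₂ (vertexAt-At p t (<⇒≤ lt) , vertexAt-At p (suc t) lt)

  Col : Set
  Col = Vertex → ℕ

  TwoColoured : Col → Set
  TwoColoured col = ∀ y → col y ≡ ca ⊎ col y ≡ cb

  bit : Col → Vertex → Bool
  bit col y = col y ≡ᵇ ca

  word : Col → (p : Fin n) → Vec Bool (suc (len p))
  word col p = build (λ t → bit col (vertexAt p t)) (suc (len p))

  bitAt-word : ∀ col p t → t ≤ len p → bitAt (word col p) t ≡ bit col (vertexAt p t)
  bitAt-word col p t le = bitAt-build (λ t → bit col (vertexAt p t)) (suc (len p)) t (s≤s le)

  ca≡ : ∀ {x} → (x ≡ᵇ ca) ≡ true → x ≡ ca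
  ca≡ {x} e = ≡ᵇ⇒≡ x ca (≡true⇒T e)

  ≡ca : ∀ {x} → x ≡ ca → (x ≡ᵇ ca) ≡ true
  ≡ca {x} refl = T⇒≡true (≡⇒≡ᵇ x x refl)

  ≢ca : ∀ {x} → x ≢ ca → (x ≡ᵇ ca) ≡ false
  ≢ca {x} ne with x ≡ᵇ ca in e
  ... | true = ⊥-elim (ne (ca≡ e))
  ... | false = refl

  bit-injective : ∀ {col} → TwoColoured col → ∀ y z → bit col y ≡ bit col z → col y ≡ col z
  bit-injective {col} tc y z e with tc y | tc z
  ... | inj₁ p | inj₁ q = trans p (sym q)
  ... | inj₂ p | inj₂ q = trans p (sym q)
  ... | inj₁ p | inj₂ q with col z ≟ ca
  ...   | yes r = trans p (sym r)
  ...   | no r = ⊥-elim (bnot (trans (sym (≡ca p)) (trans e (≢ca r))))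
    where
    bnot : true ≢ false
    bnot ()
  bit-injective {col} tc y z e | inj₂ p | inj₁ q with col y ≟ ca
  ...   | yes r = trans r (sym q)
  ...   | no r = ⊥-elim (bnot (trans (sym (≡ca q)) (trans (sym e) (≢ca r))))
    where
    bnot : true ≢ false
    bnot ()

  bit-≢ : ∀ {col} → TwoColoured col → ∀ y z → col y ≢ col z → bit col z ≡ not (bit col y)
  bit-≢ {col} tc y z ne with bit col y | bit col z | bit-injective tc y z
  ... | true | true | f = ⊥-elim (ne (f refl))
  ... | true | false | f = refl
  ... | false | true | f = refl
  ... | false | false | f = ⊥-elim (ne (f refl))

  Reach-colour : ∀ {col c x y} → Reach G col c x y → col y ≡ c
  Reach-colour (here e) = e
  Reach-colour (step r a e) = e

  colourAt : ∀ {col} → TwoColoured col → ∀ x p t → t ≤ len p → bitAt (word col p) t ≡ bit col x → col (vertexAt p t) ≡ col x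
  colourAt {col} tc x p t le e = bit-injective tc (vertexAt p t) x (trans (sym (bitAt-word col p t le)) e)

  module Walk (col : Col) (tc : TwoColoured col) (x : Vertex) where
    c = col x
    b = bit col x

    R : Vertex → Set
    R y = Reach G col c x y

    step-forward : ∀ p t → t < len p → R (vertexAt p t) → bitAt (word col p) (suc t) ≡ b → R (vertexAt p (suc t))
    step-forward p t lt r e = step r (vertexAt-adj p t lt) (colourAt tc x p (suc t) lt e)

    step-backward : ∀ p t → t < len p → R (vertexAt p (suc t)) → bitAt (word col p) t ≡ b → R (vertexAt p t)
    step-backward p t lt r e = step r (vertexAt-adj′ p t lt) (colourAt tc x p t (<⇒≤ lt) e)

    walk-from-u : ∀ p t → t ≤ len p → T (prefixRun (word col p) b t) → R uVertex → R (vertexAt p t)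
    walk-from-u p zero le m r = r
    walk-from-u p (suc t) le m r with prefixRun-step (len p) (len≤6 p) (word col p) b t le m
    ... | m' , e = step-forward p t le (walk-from-u p t (<⇒≤ le) m' r) e

    walk-from-v : ∀ k p t → k + t ≡ len p → T (suffixRun (len p) (word col p) b t) → R vVertex → R (vertexAt p t)
    walk-from-v zero p t e m r = subst R (trans (sym (vertexAt-len p)) (cong (vertexAt p) (sym e))) r
    walk-from-v (suc k) p t e m r with suffixRun-step (len p) (len≤6 p) (word col p) b t lt m
      where lt = subst (t <_) e (s≤s (m≤n+m t k))
    ... | m' , e2 = step-backward p t lt (walk-from-v k p (suc t) (trans (+-suc k t) e) m' r) e2
      where lt = subst (t <_) e (s≤s (m≤n+m t k))

    walk-to-u : ∀ p t → t ≤ len p → T (prefixRun (word col p) b t) → R (vertexAt p t) → R uVertex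
    walk-to-u p zero le m r = r
    walk-to-u p (suc t) le m r with prefixRun-step (len p) (len≤6 p) (word col p) b t le m
    ... | m' , e = walk-to-u p t (<⇒≤ le) m' (step-backward p t le r (prefixRun-bit (len p) (len≤6 p) (word col p) b t (<⇒≤ le) m'))

    walk-to-v : ∀ k p t → k + t ≡ len p → T (suffixRun (len p) (word col p) b t) → R (vertexAt p t) → R vVertex
    walk-to-v zero p t e m r = subst R (trans (cong (vertexAt p) e) (vertexAt-len p)) r
    walk-to-v (suc k) p t e m r with suffixRun-step (len p) (len≤6 p) (word col p) b t lt m
      where lt = subst (t <_) e (s≤s (m≤n+m t k))
    ... | m' , e2 = walk-to-v k p (suc t) (trans (+-suc k t) e) m'
          (step-forward p t lt r (suffixRun-bit (len p) (len≤6 p) (word col p) b (suc t) lt m'))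
      where lt = subst (t <_) e (s≤s (m≤n+m t k))

    walk-inner-down : ∀ p0 t0 → t0 ≤ len p0 → R (vertexAt p0 t0) → ∀ k t → t + k ≡ t0 → T (innerBlob (word col p0) b t0 t) → R (vertexAt p0 t)
    walk-inner-down p0 t0 le r zero t e m = subst R (cong (vertexAt p0) (trans (sym e) (+-identityʳ t))) r
    walk-inner-down p0 t0 le r (suc k) t e m =
      step-backward p0 t lt (walk-inner-down p0 t0 le r k (suc t) (trans (sym (+-suc t k)) e) (innerBlob-up (len p0) (len≤6 p0) (word col p0) b t0 t le lt0 m))
        (innerBlob-bit (len p0) (len≤6 p0) (word col p0) b t0 t le (<⇒≤ lt) m)
      where
      lt0 : t < t0
      lt0 = subst (t <_) e (m<m+n t (s≤s z≤n))
      lt : t < len p0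
      lt = <-≤-trans lt0 le

    walk-inner-up : ∀ p0 t0 → t0 ≤ len p0 → R (vertexAt p0 t0) → ∀ k t → t ≡ t0 + k → t ≤ len p0 → T (innerBlob (word col p0) b t0 t) → R (vertexAt p0 t)
    walk-inner-up p0 t0 le r zero t e le2 m = subst R (cong (vertexAt p0) (sym (trans e (+-identityʳ t0)))) r
    walk-inner-up p0 t0 le r (suc k) t e le2 m =
      subst R (cong (vertexAt p0) (sym e'))
        (step-forward p0 (t0 + k) lt (walk-inner-up p0 t0 le r k (t0 + k) refl (<⇒≤ lt)
           (innerBlob-down (len p0) (len≤6 p0) (word col p0) b t0 (t0 + k) le (m≤m+n t0 k) lt (subst (λ z → T (innerBlob (word col p0) b t0 z)) e' m)))
          (subst (λ z → bitAt (word col p0) z ≡ b) e' (innerBlob-bit (len p0) (len≤6 p0) (word col p0) b t0 t le le2 m)))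
      where
      e' : t ≡ suc (t0 + k)
      e' = trans e (+-suc t0 k)
      lt : t0 + k < len p0
      lt = subst (_≤ len p0) e' le2

  Fin-eqᵇ : ∀ {m} → Fin m → Fin m → Bool
  Fin-eqᵇ zero zero = true
  Fin-eqᵇ zero (suc q) = false
  Fin-eqᵇ (suc p) zero = false
  Fin-eqᵇ (suc p) (suc q) = Fin-eqᵇ p q

  Fin-eqᵇ-refl : ∀ {m} (p : Fin m) → Fin-eqᵇ p p ≡ true
  Fin-eqᵇ-refl zero = refl
  Fin-eqᵇ-refl (suc p) = Fin-eqᵇ-refl p

  Fin-eqᵇ-sound : ∀ {m} (p q : Fin m) → Fin-eqᵇ p q ≡ true → p ≡ q
  Fin-eqᵇ-sound zero zero e = refl
  Fin-eqᵇ-sound zero (suc q) ()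
  Fin-eqᵇ-sound (suc p) zero ()
  Fin-eqᵇ-sound (suc p) (suc q) e = cong suc (Fin-eqᵇ-sound p q e)

  anyFin : ∀ m → (Fin m → Bool) → Bool
  anyFin zero f = false
  anyFin (suc m) f = f zero ∨ anyFin m (λ p → f (suc p))

  anyFin-sound : ∀ m f → anyFin m f ≡ true → Σ (Fin m) λ p → f p ≡ true
  anyFin-sound (suc m) f e with f zero in e0
  ... | true = zero , e0
  ... | false with anyFin-sound m (λ p → f (suc p)) e
  ... | p , e1 = suc p , e1

  anyFin-complete : ∀ m f p → f p ≡ true → anyFin m f ≡ true
  anyFin-complete (suc m) f zero e rewrite e = refl
  anyFin-complete (suc m) f (suc p) e with f zero
  ... | true = refl
  ... | false = anyFin-complete m (λ p → f (suc p)) p e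

  atEndpoint : (s' : Bool) → Endpt s' → Bool → Bool → Bool
  atEndpoint true false U V = U
  atEndpoint true true U V = V
  atEndpoint false tt U V = U

  atEndpoint-u : ∀ s' U V → atEndpoint s' (uE s') U V ≡ U
  atEndpoint-u true U V = refl
  atEndpoint-u false U V = refl

  atEndpoint-v : ∀ s' U V → (s' ≡ false → U ≡ V) → atEndpoint s' (vE s') U V ≡ V
  atEndpoint-v true U V h = refl
  atEndpoint-v false U V h = h refl

  endpoint-cases : ∀ s' (e : Endpt s') → e ≡ uE s' ⊎ (s' ≡ true × e ≡ vE s')
  endpoint-cases true false = inj₁ refl
  endpoint-cases true true = inj₂ (refl , refl)
  endpoint-cases false tt = inj₁ refl

  vVertex≡uVertex : s ≡ false → vVertex ≡ uVertex
  vVertex≡uVertex e = lem s e where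
    lem : ∀ s' → s' ≡ false → _≡_ {A = Vtx s' ls} (inj₁ (vE s')) (inj₁ (uE s'))
    lem false refl = refl

  -- The component recoloured by a move is either a run strictly inside one path (innerShape p t₀,
  -- around position t₀ of path p), or contains u (when U) and/or v (when V) together with the
  -- monochromatic prefixes resp. suffixes of all paths.
  data BlobShape : Set where
    innerShape : Fin n → ℕ → BlobShape
    endShape : Bool → Bool → BlobShape

  module Blob (col : Col) (tc : TwoColoured col) (x : Vertex) where
    open Walk col tc x public

    flippedOnPath : BlobShape → Fin n → ℕ → Bool
    flippedOnPath (innerShape p0 t0) p t = if Fin-eqᵇ p p0 then innerBlob (word col p) b t0 t else false
    flippedOnPath (endShape U V) p t = endBlob (len p) (word col p) b U V t

    flipped : BlobShape → Vertex → Bool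
    flipped (innerShape _ _) (inj₁ _) = false
    flipped (endShape U V) (inj₁ e) = atEndpoint s e U V
    flipped d (inj₂ (p , t , _)) = flippedOnPath d p t

    monochromePath : Fin n → Bool
    monochromePath p = prefixRun (word col p) b (len p)

    record ValidEndShape (U V : Bool) : Set where
      field
        hU : U ≡ true → bit col uVertex ≡ b
        hV : V ≡ true → bit col vVertex ≡ b
        hUV : ∀ p → V ≡ true → T (monochromePath p) → U ≡ true
        hVU : ∀ p → U ≡ true → T (monochromePath p) → V ≡ true
        hs : s ≡ false → U ≡ V
        hm : s ≡ true → U ≡ true → V ≡ true → Σ (Fin n) λ p → monochromePath p ≡ true
        rU : U ≡ true → R uVertex
        rV : V ≡ true → R vVertex
        flipped-self : T (flipped (endShape U V) x)

    record ValidInnerShape (p0 : Fin n) (t0 : ℕ) : Set where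
      field
        pos0 : 0 < t0
        lt0 : t0 < len p0
        xeq : x ≡ vertexAt p0 t0
        b0 : innerBlob (word col p0) b t0 0 ≡ false
        bL : innerBlob (word col p0) b t0 (len p0) ≡ false

    Valid : BlobShape → Set
    Valid (innerShape p0 t0) = ValidInnerShape p0 t0
    Valid (endShape U V) = ValidEndShape U V

    flipped-vertexAt′ : ∀ d → (∀ p → flipped d uVertex ≡ flippedOnPath d p 0) → (∀ p → flipped d vVertex ≡ flippedOnPath d p (len p))
          → ∀ p t → t ≤ len p → flipped d (vertexAt p t) ≡ flippedOnPath d p t
    flipped-vertexAt′ d h0 hL p zero le = h0 p
    flipped-vertexAt′ d h0 hL p (suc t) le with suc t <? len p
    ... | yes h = βvtxMid d where
      βvtxMid : ∀ d → flipped d (inj₂ (p , suc t , s≤s z≤n , h)) ≡ flippedOnPath d p (suc t)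
      βvtxMid (innerShape _ _) = refl
      βvtxMid (endShape _ _) = refl
    ... | no nh rewrite ≤∧≮⇒≡ le nh = hL p

    flipped-vertexAt : ∀ d → Valid d → ∀ p t → t ≤ len p → flipped d (vertexAt p t) ≡ flippedOnPath d p t
    flipped-vertexAt (endShape U V) vd = flipped-vertexAt′ (endShape U V) h0 hL where
      open ValidEndShape vd
      h0 : ∀ p → flipped (endShape U V) uVertex ≡ flippedOnPath (endShape U V) p 0
      h0 p = trans (atEndpoint-u s U V) (sym (endBlob-start (len p) (len≤6 p) (word col p) b U V
               (λ e → trans (bitAt-word col p 0 z≤n) (hU e)) (λ e m → hUV p e m)))
      hL : ∀ p → flipped (endShape U V) vVertex ≡ flippedOnPath (endShape U V) p (len p)
      hL p = trans (atEndpoint-v s U V hs) (sym (endBlob-end (len p) (len≤6 p) (word col p) b U V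
               (λ e → trans (bitAt-word col p (len p) ≤-refl) (trans (cong (bit col) (vertexAt-len p)) (hV e))) (λ e m → hVU p e m)))
    flipped-vertexAt (innerShape p0 t0) vd = flipped-vertexAt′ (innerShape p0 t0) h0 hL where
      open ValidInnerShape vd
      h0 : ∀ p → false ≡ flippedOnPath (innerShape p0 t0) p 0
      h0 p with Fin-eqᵇ p p0 in e
      ... | false = refl
      ... | true rewrite Fin-eqᵇ-sound p p0 e = sym b0
      hL : ∀ p → false ≡ flippedOnPath (innerShape p0 t0) p (len p)
      hL p with Fin-eqᵇ p p0 in e
      ... | false = refl
      ... | true rewrite Fin-eqᵇ-sound p p0 e = sym bL

    flipped-forward : ∀ d → Valid d → ∀ p t → t < len p → T (flippedOnPath d p t) → bitAt (word col p) (suc t) ≡ b → T (flippedOnPath d p (suc t))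
    flipped-forward (endShape U V) vd p t lt m e = endBlob-forward (len p) (len≤6 p) (word col p) b U V t lt m e
    flipped-forward (innerShape p0 t0) vd p t lt m e with Fin-eqᵇ p p0 in q
    ... | true rewrite Fin-eqᵇ-sound p p0 q = innerBlob-forward (len p0) (len≤6 p0) (word col p0) b t0 t (<⇒≤ (ValidInnerShape.lt0 vd)) lt m e

    flipped-backward : ∀ d → Valid d → ∀ p t → t < len p → T (flippedOnPath d p (suc t)) → bitAt (word col p) t ≡ b → T (flippedOnPath d p t)
    flipped-backward (endShape U V) vd p t lt m e = endBlob-backward (len p) (len≤6 p) (word col p) b U V t lt m e
    flipped-backward (innerShape p0 t0) vd p t lt m e with Fin-eqᵇ p p0 in q
    ... | true rewrite Fin-eqᵇ-sound p p0 q = innerBlob-backward (len p0) (len≤6 p0) (word col p0) b t0 t (<⇒≤ (ValidInnerShape.lt0 vd)) lt m e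

    innerBlob-self : ∀ p0 t0 → t0 ≤ len p0 → x ≡ vertexAt p0 t0 → T (innerBlob (word col p0) b t0 t0)
    innerBlob-self p0 t0 le xe rewrite T⇒≡true (≤⇒≤ᵇ (≤-refl {t0})) | n∸n≡0 t0 =
      ≡⇒sameBit (trans (bitAt-word col p0 t0 le) (cong (bit col) (sym xe)))

    flipped-self-inner : ∀ p0 t0 → ValidInnerShape p0 t0 → T (flipped (innerShape p0 t0) x)
    flipped-self-inner p0 t0 vd = subst T (sym (trans (cong (flipped (innerShape p0 t0)) (ValidInnerShape.xeq vd)) (flipped-vertexAt (innerShape p0 t0) vd p0 t0 le))) h
      where
      le = <⇒≤ (ValidInnerShape.lt0 vd)
      h : T (flippedOnPath (innerShape p0 t0) p0 t0)
      h rewrite Fin-eqᵇ-refl p0 = innerBlob-self p0 t0 le (ValidInnerShape.xeq vd)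

    flipped-self : ∀ d → Valid d → T (flipped d x)
    flipped-self (endShape U V) vd = ValidEndShape.flipped-self vd
    flipped-self (innerShape p0 t0) vd = flipped-self-inner p0 t0 vd

    colour⇒bit : ∀ {y} → col y ≡ c → bit col y ≡ b
    colour⇒bit e = cong (_≡ᵇ ca) e

    Reach⇒flipped : ∀ d → Valid d → ∀ {y} → R y → T (flipped d y)
    Reach⇒flipped d vd (here e) = flipped-self d vd
    Reach⇒flipped d vd (step {w} {y} r (p , t , inj₁ (aw , ay)) e) =
      subst (λ z → T (flipped d z)) (sym ye) (subst T (sym (flipped-vertexAt d vd p (suc t) le)) (flipped-forward d vd p t le m1 eb))
      where
      we = At⇒vertexAt aw
      ye = At⇒vertexAt ay
      le = At⇒≤len ay
      m1 : T (flippedOnPath d p t)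
      m1 = subst T (flipped-vertexAt d vd p t (<⇒≤ le)) (subst (λ z → T (flipped d z)) we (Reach⇒flipped d vd r))
      eb : bitAt (word col p) (suc t) ≡ b
      eb = trans (bitAt-word col p (suc t) le) (trans (cong (bit col) (sym ye)) (colour⇒bit e))
    Reach⇒flipped d vd (step {w} {y} r (p , t , inj₂ (ay , aw)) e) =
      subst (λ z → T (flipped d z)) (sym ye) (subst T (sym (flipped-vertexAt d vd p t (<⇒≤ le))) (flipped-backward d vd p t le m1 eb))
      where
      we = At⇒vertexAt aw
      ye = At⇒vertexAt ay
      le = At⇒≤len aw
      m1 : T (flippedOnPath d p (suc t))
      m1 = subst T (flipped-vertexAt d vd p (suc t) le) (subst (λ z → T (flipped d z)) we (Reach⇒flipped d vd r))
      eb : bitAt (word col p) t ≡ b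
      eb = trans (bitAt-word col p t (<⇒≤ le)) (trans (cong (bit col) (sym ye)) (colour⇒bit e))

    flipped⇒Reach : ∀ d → Valid d → ∀ y → T (flipped d y) → R y
    flipped⇒Reach (endShape U V) vd (inj₁ e) m with endpoint-cases s e
    ... | inj₁ refl = ValidEndShape.rU vd (trans (sym (atEndpoint-u s U V)) (T⇒≡true m))
    ... | inj₂ (_ , refl) = ValidEndShape.rV vd (trans (sym (atEndpoint-v s U V (ValidEndShape.hs vd))) (T⇒≡true m))
    flipped⇒Reach (endShape U V) vd (inj₂ (p , t , h1 , h2)) m with T-∨-split {U ∧ prefixRun (word col p) b t} m
    ... | inj₁ m1 = subst R (vertexAt-inner p t h1 h2) (walk-from-u p t (<⇒≤ h2) (T-∧-snd {U} m1) (ValidEndShape.rU vd (T⇒≡true (T-∧-fst m1))))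
    ... | inj₂ m2 = subst R (vertexAt-inner p t h1 h2) (walk-from-v (len p ∸ t) p t (m∸n+n≡m (<⇒≤ h2)) (T-∧-snd {V} m2) (ValidEndShape.rV vd (T⇒≡true (T-∧-fst m2))))
    flipped⇒Reach (innerShape p0 t0) vd (inj₂ (p , t , h1 , h2)) m with Fin-eqᵇ p p0 in q
    ... | true with Fin-eqᵇ-sound p p0 q
    ... | refl = subst R (vertexAt-inner p t h1 h2) walk
      where
      open ValidInnerShape vd
      le0 = <⇒≤ lt0
      rx : R (vertexAt p t0)
      rx = subst R xeq (here refl)
      walk : R (vertexAt p t)
      walk with t ≤? t0
      ... | yes le = walk-inner-down p t0 le0 rx (t0 ∸ t) t (m+[n∸m]≡n le) m
      ... | no nle = walk-inner-up p t0 le0 rx (t ∸ t0) t (sym (m+[n∸m]≡n (<⇒≤ (≰⇒> nle)))) (<⇒≤ h2) m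

    someMonochrome : Bool
    someMonochrome = anyFin n monochromePath

    or-cases′ : ∀ s' {a} → (not s' ∨ a) ≡ true → s' ≡ false ⊎ a ≡ true
    or-cases′ false e = inj₁ refl
    or-cases′ true e = inj₂ e

    or-cases : ∀ {a} → (not s ∨ a) ≡ true → s ≡ false ⊎ a ≡ true
    or-cases = or-cases′ s

    not-false-∨ : ∀ s' a → s' ≡ false → (not s' ∨ a) ≡ true
    not-false-∨ false a refl = refl

    not-true-∨ : ∀ s' a → s' ≡ true → (not s' ∨ a) ≡ a
    not-true-∨ true a refl = refl

    sameBlob-merged : s ≡ false → (not s ∨ someMonochrome) ≡ true
    sameBlob-merged = not-false-∨ s someMonochrome

    sameBlob-apart : s ≡ true → (not s ∨ someMonochrome) ≡ someMonochrome
    sameBlob-apart = not-true-∨ s someMonochrome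

    monochrome-vVertex : ∀ p → T (monochromePath p) → bit col vVertex ≡ b
    monochrome-vVertex p m = trans (cong (bit col) (sym (vertexAt-len p))) (trans (sym (bitAt-word col p (len p) ≤-refl)) (prefixRun-bit (len p) (len≤6 p) (word col p) b (len p) ≤-refl m))

    monochrome-uVertex : ∀ p → T (monochromePath p) → bit col uVertex ≡ b
    monochrome-uVertex p m = trans (sym (bitAt-word col p 0 z≤n)) (suffixRun-bit (len p) (len≤6 p) (word col p) b 0 z≤n m)

    valid-from-uVertex : R uVertex → T (flipped (endShape true (not s ∨ someMonochrome)) x) → ValidEndShape true (not s ∨ someMonochrome)
    valid-from-uVertex ru xi = record
      { hU = λ _ → bu
      ; hV = hV
      ; hUV = λ _ _ _ → refl
      ; hVU = λ p _ m → trans (cong (not s ∨_) (anyFin-complete n monochromePath p (T⇒≡true m))) (∨-zeroʳ (not s))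
      ; hs = λ e → sym (sameBlob-merged e)
      ; hm = λ e _ v → anyFin-sound n monochromePath (trans (sym (sameBlob-apart e)) v)
      ; rU = λ _ → ru
      ; rV = rV
      ; flipped-self = xi }
      where
      bu = colour⇒bit (Reach-colour ru)
      hV : (not s ∨ someMonochrome) ≡ true → bit col vVertex ≡ b
      hV e with or-cases e
      ... | inj₁ sf = trans (cong (bit col) (vVertex≡uVertex sf)) bu
      ... | inj₂ a with anyFin-sound n monochromePath a
      ... | p , m = monochrome-vVertex p (≡true⇒T m)
      rV : (not s ∨ someMonochrome) ≡ true → R vVertex
      rV e with or-cases e
      ... | inj₁ sf = subst R (sym (vVertex≡uVertex sf)) ru
      ... | inj₂ a with anyFin-sound n monochromePath a
      ... | p , m = subst R (vertexAt-len p) (walk-from-u p (len p) ≤-refl (≡true⇒T m) ru)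

    valid-from-vVertex : R vVertex → T (flipped (endShape (not s ∨ someMonochrome) true) x) → ValidEndShape (not s ∨ someMonochrome) true
    valid-from-vVertex rv xi = record
      { hU = hU
      ; hV = λ _ → bv
      ; hUV = λ p _ m → trans (cong (not s ∨_) (anyFin-complete n monochromePath p (T⇒≡true m))) (∨-zeroʳ (not s))
      ; hVU = λ _ _ _ → refl
      ; hs = λ e → sameBlob-merged e
      ; hm = λ e u _ → anyFin-sound n monochromePath (trans (sym (sameBlob-apart e)) u)
      ; rU = rU
      ; rV = λ _ → rv
      ; flipped-self = xi }
      where
      bv = colour⇒bit (Reach-colour rv)
      hU : (not s ∨ someMonochrome) ≡ true → bit col uVertex ≡ b
      hU e with or-cases e
      ... | inj₁ sf = trans (cong (bit col) (sym (vVertex≡uVertex sf))) bv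
      ... | inj₂ a with anyFin-sound n monochromePath a
      ... | p , m = monochrome-uVertex p (≡true⇒T m)
      rU : (not s ∨ someMonochrome) ≡ true → R uVertex
      rU e with or-cases e
      ... | inj₁ sf = subst R (vVertex≡uVertex sf) rv
      ... | inj₂ a with anyFin-sound n monochromePath a
      ... | p , m = walk-from-v (len p) p 0 (+-identityʳ (len p)) (≡true⇒T m) rv

    <⇒≤ᵇ-false : ∀ {m k} → m < k → (k ≤ᵇ m) ≡ false
    <⇒≤ᵇ-false {m} {k} lt with k ≤ᵇ m in e
    ... | true = ⊥-elim (<⇒≱ lt (≤ᵇ⇒≤ k m (≡true⇒T e)))
    ... | false = refl

    classify′ : ∀ y → x ≡ y → Σ BlobShape Valid
    classify′ (inj₁ e) xe with endpoint-cases s e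
    ... | inj₁ refl = endShape true (not s ∨ someMonochrome) , valid-from-uVertex (subst R xe (here refl)) (subst (λ z → T (flipped (endShape true (not s ∨ someMonochrome)) z)) (sym xe) (≡true⇒T (atEndpoint-u s true _)))
    ... | inj₂ (st , refl) = endShape (not s ∨ someMonochrome) true , valid-from-vVertex (subst R xe (here refl)) (subst (λ z → T (flipped (endShape (not s ∨ someMonochrome) true) z)) (sym xe) (≡true⇒T (atEndpoint-v s _ true (λ sf → ⊥-elim (tf (trans (sym st) sf))))))
      where
      tf : true ≢ false
      tf ()
    classify′ (inj₂ (p0 , t0 , h1 , h2)) xe with prefixRun (word col p0) b t0 in m1
    ... | true = endShape true (not s ∨ someMonochrome) , valid-from-uVertex (walk-to-u p0 t0 (<⇒≤ h2) (≡true⇒T m1) rx) (subst (λ z → T (flipped (endShape true (not s ∨ someMonochrome)) z)) (sym xe) xi)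
      where
      rx : R (vertexAt p0 t0)
      rx = subst R (trans xe (sym (vertexAt-inner p0 t0 h1 h2))) (here refl)
      xi : T (endBlob (len p0) (word col p0) b true (not s ∨ someMonochrome) t0)
      xi rewrite m1 = tt
    ... | false with suffixRun (len p0) (word col p0) b t0 in m2
    ...   | true = endShape (not s ∨ someMonochrome) true , valid-from-vVertex (walk-to-v (len p0 ∸ t0) p0 t0 (m∸n+n≡m (<⇒≤ h2)) (≡true⇒T m2) rx) (subst (λ z → T (flipped (endShape (not s ∨ someMonochrome) true) z)) (sym xe) xi)
      where
      rx : R (vertexAt p0 t0)
      rx = subst R (trans xe (sym (vertexAt-inner p0 t0 h1 h2))) (here refl)
      xi : T (endBlob (len p0) (word col p0) b (not s ∨ someMonochrome) true t0)
      xi rewrite m2 = subst T (sym (∨-zeroʳ _)) tt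
    ...   | false = innerShape p0 t0 , record { pos0 = h1 ; lt0 = h2 ; xeq = trans xe (sym (vertexAt-inner p0 t0 h1 h2)) ; b0 = m1 ; bL = bL' }
      where
      bL' : innerBlob (word col p0) b t0 (len p0) ≡ false
      bL' rewrite <⇒≤ᵇ-false h2 = m2

    blobShape : Σ BlobShape Valid
    blobShape = classify′ x refl

  changesOn : Col → Fin n → ℕ
  changesOn col p = changes (word col p)

  changeCount : Col → ℕ → ℕ
  changeCount col = count n (changesOn col)

  endsDiffer : Col → Bool
  endsDiffer col = bit col uVertex xor bit col vVertex

  abstractPos : Col → Pos
  abstractPos col = encode s (changeCount col) (endsDiffer col)

  changesOn-≤ : ∀ col p → changesOn col p ≤ 6
  changesOn-≤ col p = ≤-trans (changes-≤ (len p) (len≤6 p) (word col p)) (len≤6 p)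

  changesOn-parity : ∀ col p → isEven (changesOn col p) ≡ not (bit col uVertex xor bit col vVertex)
  changesOn-parity col p = trans (changes-parity (len p) (len≤6 p) (word col p))
    (cong₂ (λ y z → not (y xor z)) (bitAt-word col p 0 z≤n) (trans (bitAt-word col p (len p) ≤-refl) (cong (bit col) (vertexAt-len p))))

  xor-when-merged : ∀ s' x y → (s' ≡ false → x ≡ y) → (x xor y) ≡ (s' ∧ (x xor y))
  xor-when-merged true x y h = refl
  xor-when-merged false true true h = refl
  xor-when-merged false false false h = refl
  xor-when-merged false true false h with h refl
  ... | ()
  xor-when-merged false false true h with h refl
  ... | ()

  admissible : ∀ col → Admissible s (changeCount col) (endsDiffer col)
  admissible col = record { vanish-≥7 = bz ; parity = pt }
    where
    bz : ∀ k → 7 ≤ k → changeCount col k ≡ 0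
    bz k le = count-absent n (changesOn col) k (λ p e → <-irrefl refl (≤-trans le (subst (_≤ 6) e (changesOn-≤ col p))))
    pt : ∀ k → changeCount col k ≢ 0 → isEven k ≡ not (s ∧ endsDiffer col)
    pt k ne with count-nonzero n (changesOn col) k ne
    ... | p , e = trans (cong isEven (sym e)) (trans (changesOn-parity col p) (cong not (xor-when-merged s _ _ (λ sf → cong (bit col) (sym (vVertex≡uVertex sf))))))

  true≢false : true ≢ false
  true≢false ()

  even⇒≢1 : ∀ {k} → isEven k ≡ true → k ≢ 1
  even⇒≢1 e refl with e
  ... | ()

  edge-changes : ∀ col {y z} → Graph.Adj G y z → bit col z ≡ not (bit col y) → Σ (Fin n) λ p → 1 ≤ changesOn col p
  edge-changes col {y} {z} (p , t , inj₁ (ay , az)) bz = p , changes-positive (len p) (len≤6 p) (word col p) t (At⇒≤len az) dif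
    where
    dif : bitAt (word col p) t ≢ bitAt (word col p) (suc t)
    dif e = not-¬ {bit col y} refl (trans (trans (cong (bit col) (At⇒vertexAt ay)) (sym (bitAt-word col p t (<⇒≤ (At⇒≤len az)))))
                (trans e (trans (bitAt-word col p (suc t) (At⇒≤len az)) (trans (cong (bit col) (sym (At⇒vertexAt az))) bz))))
  edge-changes col {y} {z} (p , t , inj₂ (az , ay)) bz = p , changes-positive (len p) (len≤6 p) (word col p) t (At⇒≤len ay) dif
    where
    dif : bitAt (word col p) t ≢ bitAt (word col p) (suc t)
    dif e = not-¬ {bit col y} refl (trans (trans (cong (bit col) (At⇒vertexAt ay)) (sym (bitAt-word col p (suc t) (At⇒≤len ay))))
                (trans (sym e) (trans (bitAt-word col p t (<⇒≤ (At⇒≤len ay))) (trans (cong (bit col) (sym (At⇒vertexAt az))) bz))))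

  module MoveEffect (col : Col) (tc : TwoColoured col) (x w : Vertex) (adj : Graph.Adj G x w) (ne : col w ≢ col x) (q : Col)
    (onR : ∀ y → Reach G col (col x) x y → q y ≡ col w)
    (offR : ∀ y → ¬ Reach G col (col x) x y → q y ≡ col y) where

    open Blob col tc x

    bit-w : bit col w ≡ not b
    bit-w = bit-≢ tc x w (λ e → ne (sym e))

    module Flipped (d : BlobShape) (vd : Valid d) where

      q-flipped : ∀ y → q y ≡ (if flipped d y then col w else col y)
      q-flipped y with flipped d y in e
      ... | true = onR y (flipped⇒Reach d vd y (≡true⇒T e))
      ... | false = offR y (λ r → subst T e (Reach⇒flipped d vd r))

      q-twoColoured : TwoColoured q
      q-twoColoured y rewrite q-flipped y with flipped d y
      ... | true = tc w
      ... | false = tc y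

      bit-q : ∀ y → bit q y ≡ (if flipped d y then not b else bit col y)
      bit-q y rewrite q-flipped y with flipped d y
      ... | true = bit-w
      ... | false = refl

      word-q : ∀ p → word q p ≡ flipWhere (flippedOnPath d p) (word col p) b
      word-q p = build-ext _ _ (suc (len p)) (λ t lt → trans (bit-q (vertexAt p t))
        (trans (cong (λ z → if z then not b else bit col (vertexAt p t)) (flipped-vertexAt d vd p t (≤-pred lt)))
               (cong (λ z → if flippedOnPath d p t then not b else z) (sym (bitAt-word col p t (≤-pred lt))))))

      changesOn-q : ∀ p → changesOn q p ≡ changes (flipWhere (flippedOnPath d p) (word col p) b)
      changesOn-q p = cong changes (word-q p)

      edge : Σ (Fin n) λ p → 1 ≤ changesOn col p
      edge = edge-changes col adj bit-w

    Fin-eqᵇ-≢ : ∀ (p p0 : Fin n) → p ≢ p0 → Fin-eqᵇ p p0 ≡ false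
    Fin-eqᵇ-≢ p p0 ne with Fin-eqᵇ p p0 in e
    ... | true = ⊥-elim (ne (Fin-eqᵇ-sound p p0 e))
    ... | false = refl

    effect-inner : ∀ p0 t0 → (vd : ValidInnerShape p0 t0) → option (kindOf (changesOn col p0)) (abstractPos col) ≡ just (abstractPos q)
    effect-inner p0 t0 vd = subst (λ z → option (kindOf r0) (abstractPos col) ≡ just (encode s (changeCount q) z)) (sym parq)
                      (encode-inner s (changeCount col) (changeCount q) (endsDiffer col) r0 (admissible col) two (changesOn-≤ col p0) (count-member n (changesOn col) p0) eq')
      where
      open ValidInnerShape vd
      open Flipped (innerShape p0 t0) vd
      r0 = changesOn col p0
      rq0 : changesOn q p0 + 2 ≡ r0
      rq0 = trans (cong (_+ 2) (trans (changesOn-q p0) (cong changes (flipWhere-cong _ _ (word col p0) b (λ t → cong (λ z → if z then innerBlob (word col p0) b t0 t else false) (Fin-eqᵇ-refl p0))))))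
              (flipInner-changes (len p0) (len≤6 p0) (word col p0) b t0 lt0 pos0 (trans (bitAt-word col p0 t0 (<⇒≤ lt0)) (cong (bit col) (sym xeq))) b0 bL)
      rqo : ∀ p → p ≢ p0 → changesOn q p ≡ changesOn col p
      rqo p ne' = trans (changesOn-q p) (cong changes (trans (flipWhere-cong _ _ (word col p) b (λ t → cong (λ z → if z then innerBlob (word col p) b t0 t else false) (Fin-eqᵇ-≢ p p0 ne'))) (flipWhere-none (word col p) b)))
      parq : endsDiffer q ≡ endsDiffer col
      parq = cong₂ _xor_ (bit-q uVertex) (bit-q vVertex)
      two : 2 ≤ r0
      two = subst (2 ≤_) rq0 (m≤n+m 2 (changesOn q p0))
      g0 : changesOn q p0 ≡ r0 ∸ 2
      g0 = trans (sym (m+n∸n≡m (changesOn q p0) 2)) (cong (_∸ 2) rq0)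
      eq' : ∀ k → changeCount q k + indicator r0 k ≡ changeCount col k + indicator (r0 ∸ 2) k
      eq' k = subst (λ z → changeCount q k + indicator r0 k ≡ changeCount col k + indicator z k) g0 (count-update n (changesOn col) (changesOn q) p0 rqo k)

    Bool-cases : ∀ s' → s' ≡ true ⊎ s' ≡ false
    Bool-cases true = inj₁ refl
    Bool-cases false = inj₂ refl

    atEndpoint-false : ∀ s' e → atEndpoint s' e false false ≡ false
    atEndpoint-false true false = refl
    atEndpoint-false true true = refl
    atEndpoint-false false tt = refl

    flipped-nothing : ∀ y → flipped (endShape false false) y ≡ false
    flipped-nothing (inj₁ e) = atEndpoint-false s e
    flipped-nothing (inj₂ _) = refl

    apart-if-asymmetric : ∀ {U V} → ValidEndShape U V → U ≢ V → s ≡ true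
    apart-if-asymmetric vd ne with Bool-cases s
    ... | inj₁ e = e
    ... | inj₂ e = ⊥-elim (ne (ValidEndShape.hs vd e))

    effect-flip-u : ValidEndShape true false → option flipEnd (abstractPos col) ≡ just (abstractPos q)
    effect-flip-u vd = subst (λ s' → option flipEnd (encode s' (changeCount col) (endsDiffer col)) ≡ just (encode s' (changeCount q) (endsDiffer q))) (sym st)
        (subst (λ z → option flipEnd (encode true (changeCount col) (endsDiffer col)) ≡ just (encode true (changeCount q) z)) (sym parq)
          (encode-flip-single (changeCount col) (changeCount q) (endsDiffer col) inv' c0 sh nzz))
      where
      open ValidEndShape vd
      open Flipped (endShape true false) vd
      st = apart-if-asymmetric vd true≢false
      inv' : Admissible true (changeCount col) (endsDiffer col)
      inv' = subst (λ s' → Admissible s' (changeCount col) (endsDiffer col)) st (admissible col)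
      mlf : ∀ p → prefixRun (word col p) b (len p) ≡ false
      mlf p with prefixRun (word col p) b (len p) in e
      ... | true = ⊥-elim (true≢false (sym (hVU p refl (≡true⇒T e))))
      ... | false = refl
      rq1 : ∀ p → changesOn q p + 1 ≡ changesOn col p
      rq1 p = trans (cong (_+ 1) (changesOn-q p)) (flipPrefix-changes (len p) (len≤6 p) (word col p) b (trans (bitAt-word col p 0 z≤n) (hU refl)) (mlf p))
      c0 : changeCount col 0 ≡ 0
      c0 = count-absent n (changesOn col) 0 (λ p e → 1+n≢0 (trans (+-comm 1 (changesOn q p)) (trans (rq1 p) e)))
      sh : ∀ k → changeCount q k ≡ changeCount col (suc k)
      sh = count-pred n (changesOn col) (changesOn q) (λ p → trans (+-comm 1 (changesOn q p)) (rq1 p))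
      nzz : Σ ℕ λ r → changeCount col (suc r) ≢ 0
      nzz with edge
      ... | p , le with changesOn col p | count-member n (changesOn col) p
      ...   | suc r' | cp = r' , cp
      parq : endsDiffer q ≡ not (endsDiffer col)
      parq = trans (cong₂ _xor_ (trans (bit-q uVertex) (cong (λ z → if z then not b else bit col uVertex) (atEndpoint-u s true false)))
                                (trans (bit-q vVertex) (cong (λ z → if z then not b else bit col vVertex) (atEndpoint-v s true false hs))))
               (trans (sym (not-distribˡ-xor b (bit col vVertex))) (cong (λ z → not (z xor bit col vVertex)) (sym (hU refl))))

    effect-flip-v : ValidEndShape false true → option flipEnd (abstractPos col) ≡ just (abstractPos q)
    effect-flip-v vd = subst (λ s' → option flipEnd (encode s' (changeCount col) (endsDiffer col)) ≡ just (encode s' (changeCount q) (endsDiffer q))) (sym st)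
        (subst (λ z → option flipEnd (encode true (changeCount col) (endsDiffer col)) ≡ just (encode true (changeCount q) z)) (sym parq)
          (encode-flip-single (changeCount col) (changeCount q) (endsDiffer col) inv' c0 sh nzz))
      where
      open ValidEndShape vd
      open Flipped (endShape false true) vd
      st = apart-if-asymmetric vd (λ e → true≢false (sym e))
      inv' : Admissible true (changeCount col) (endsDiffer col)
      inv' = subst (λ s' → Admissible s' (changeCount col) (endsDiffer col)) st (admissible col)
      mrf : ∀ p → suffixRun (len p) (word col p) b 0 ≡ false
      mrf p with suffixRun (len p) (word col p) b 0 in e
      ... | true = ⊥-elim (true≢false (sym (hUV p refl (≡true⇒T e))))
      ... | false = refl
      rq1 : ∀ p → changesOn q p + 1 ≡ changesOn col p
      rq1 p = trans (cong (_+ 1) (changesOn-q p)) (flipSuffix-changes (len p) (len≤6 p) (word col p) b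
                (trans (bitAt-word col p (len p) ≤-refl) (trans (cong (bit col) (vertexAt-len p)) (hV refl))) (mrf p))
      c0 : changeCount col 0 ≡ 0
      c0 = count-absent n (changesOn col) 0 (λ p e → 1+n≢0 (trans (+-comm 1 (changesOn q p)) (trans (rq1 p) e)))
      sh : ∀ k → changeCount q k ≡ changeCount col (suc k)
      sh = count-pred n (changesOn col) (changesOn q) (λ p → trans (+-comm 1 (changesOn q p)) (rq1 p))
      nzz : Σ ℕ λ r → changeCount col (suc r) ≢ 0
      nzz with edge
      ... | p , le with changesOn col p | count-member n (changesOn col) p
      ...   | suc r' | cp = r' , cp
      parq : endsDiffer q ≡ not (endsDiffer col)
      parq = trans (cong₂ _xor_ (trans (bit-q uVertex) (cong (λ z → if z then not b else bit col uVertex) (atEndpoint-u s false true)))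
                                (trans (bit-q vVertex) (cong (λ z → if z then not b else bit col vVertex) (atEndpoint-v s false true hs))))
               (trans (sym (not-distribʳ-xor (bit col uVertex) b)) (cong (λ z → not (bit col uVertex xor z)) (sym (hV refl))))

    effect-flip-both : ValidEndShape true true → option flipEnd (abstractPos col) ≡ just (abstractPos q)
    effect-flip-both vd = subst (λ z → option flipEnd (abstractPos col) ≡ just (encode s (changeCount q) z)) (sym parq)
          (encode-flip-double s (changeCount col) (changeCount q) (endsDiffer col) (admissible col) endsJoined h0 sh nzz)
      where
      open ValidEndShape vd
      open Flipped (endShape true true) vd
      v0 : ∀ p → bitAt (word col p) 0 ≡ b
      v0 p = trans (bitAt-word col p 0 z≤n) (hU refl)
      rq2 : ∀ p → changesOn q p ≡ changesOn col p ∸ 2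
      rq2 p = trans (changesOn-q p) (flipBothEnds-changes (len p) (len≤6 p) (word col p) b (v0 p)
                (trans (bitAt-word col p (len p) ≤-refl) (trans (cong (bit col) (vertexAt-len p)) (hV refl))))
      pc : endsDiffer col ≡ false
      pc = trans (cong₂ _xor_ (hU refl) (hV refl)) (xor-same b)
      parq : endsDiffer q ≡ endsDiffer col
      parq = trans (cong₂ _xor_ (trans (bit-q uVertex) (cong (λ z → if z then not b else bit col uVertex) (atEndpoint-u s true true)))
                                (trans (bit-q vVertex) (cong (λ z → if z then not b else bit col vVertex) (atEndpoint-v s true true hs))))
               (trans (xor-same (not b)) (sym pc))
      ne1 : ∀ p → changesOn col p ≢ 1
      ne1 p = even⇒≢1 (trans (changesOn-parity col p) (cong not pc))
      h0 : changeCount q 0 ≡ changeCount col 0 + changeCount col 2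
      h0 = count-∸2-zero n (changesOn col) (changesOn q) rq2 ne1
      sh : ∀ k → changeCount q (suc k) ≡ changeCount col (suc (suc (suc k)))
      sh = count-∸2-suc n (changesOn col) (changesOn q) rq2 ne1
      nzz : Σ ℕ λ r → changeCount col (suc (suc r)) ≢ 0
      nzz with edge
      ... | p , le with changesOn col p | count-member n (changesOn col) p | ne1 p
      ...   | suc zero | cp | n1 = ⊥-elim (n1 refl)
      ...   | suc (suc r') | cp | n1 = r' , cp
      endsJoined : s ≡ false ⊎ changeCount col 0 ≢ 0
      endsJoined with Bool-cases s
      ... | inj₂ e = inj₁ e
      ... | inj₁ e with hm e refl refl
      ...   | p , m = inj₂ (subst (λ z → changeCount col z ≢ 0) r0 (count-member n (changesOn col) p))
        where
        r0 : changesOn col p ≡ 0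
        r0 = ≡ᵇ⇒≡ _ 0 (subst T (sym (trans (changes≡0-prefixRun (len p) (len≤6 p) (word col p)) (cong (λ z → prefixRun (word col p) z (len p)) (v0 p)))) (≡true⇒T m))

    effect-flipEnd : ∀ U V → ValidEndShape U V → option flipEnd (abstractPos col) ≡ just (abstractPos q)
    effect-flipEnd false false vd = ⊥-elim (subst T (flipped-nothing x) (ValidEndShape.flipped-self vd))
    effect-flipEnd true false vd = effect-flip-u vd
    effect-flipEnd false true vd = effect-flip-v vd
    effect-flipEnd true true vd = effect-flip-both vd

  move-abstract : ∀ col → TwoColoured col → ∀ q → Move G col q → TwoColoured q × Σ MoveKind (λ k → option k (abstractPos col) ≡ just (abstractPos q))
  move-abstract col tc q (x , w , adj , ne , onR , offR) with Blob.blobShape col tc x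
  ... | innerShape p0 t0 , vd = Flipped.q-twoColoured (innerShape p0 t0) vd , kindOf (changesOn col p0) , effect-inner p0 t0 vd
    where open MoveEffect col tc x w adj ne q onR offR
  ... | endShape U V , vd = Flipped.q-twoColoured (endShape U V) vd , flipEnd , effect-flipEnd U V vd
    where open MoveEffect col tc x w adj ne q onR offR

  module MoveFrom (col : Col) (tc : TwoColoured col) (x w : Vertex) (d : BlobShape) (vd : Blob.Valid col tc x d) where
    open Blob col tc x

    q : Col
    q y = if flipped d y then col w else col y

    onR : ∀ y → Reach G col (col x) x y → q y ≡ col w
    onR y r rewrite T⇒≡true (Reach⇒flipped d vd r) = refl

    offR : ∀ y → ¬ Reach G col (col x) x y → q y ≡ col y
    offR y nr with flipped d y in e
    ... | true = ⊥-elim (nr (flipped⇒Reach d vd y (≡true⇒T e)))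
    ... | false = refl

  flipped-from-u : ∀ col tc p t0 V → t0 < len p → T (prefixRun (word col p) (bit col (vertexAt p t0)) t0) → T (Blob.flipped col tc (vertexAt p t0) (endShape true V) (vertexAt p t0))
  flipped-from-u col tc p zero V lt m = ≡true⇒T (atEndpoint-u s true V)
  flipped-from-u col tc p (suc t) V lt m = subst (λ z → T (Blob.flipped col tc (vertexAt p (suc t)) (endShape true V) z)) (sym (vertexAt-inner p (suc t) (s≤s z≤n) lt)) (T-∨-inl m)

  option-realised-inner : ∀ col (tc : TwoColoured col) k σ' → option k (abstractPos col) ≡ just σ' → k ≢ flipEnd → Σ Col λ q → Σ (Move G col q) λ _ → abstractPos q ≡ σ'
  option-realised-inner col tc k σ' e nk with inner-needs s (changeCount col) (endsDiffer col) k σ' e nk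
  ... | ni with count-nonzero n (changesOn col) (InnerNeed.r0 ni) (InnerNeed.nzr ni)
  ... | p , rp with innerStart-exists (len p) (len≤6 p) (word col p) (subst (2 ≤_) (sym rp) (InnerNeed.two ni))
  ... | t0 , ok with innerStart-spec (word col p) (len p) t0 ok
  ... | pos0 , lt , dif , b0 , bL = MoveFrom.q col tc x w d vd , (x , w , adj , ne , MoveFrom.onR col tc x w d vd , MoveFrom.offR col tc x w d vd) ,
          just-injective (trans (sym (subst (λ z → option z (abstractPos col) ≡ just (abstractPos (MoveFrom.q col tc x w d vd))) kk
            (MoveEffect.effect-inner col tc x w adj ne (MoveFrom.q col tc x w d vd) (MoveFrom.onR col tc x w d vd) (MoveFrom.offR col tc x w d vd) p t0 vd))) e)
    where
    x = vertexAt p t0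
    w = vertexAt p (suc t0)
    adj = vertexAt-adj p t0 lt
    bx : bit col x ≡ bitAt (word col p) t0
    bx = sym (bitAt-word col p t0 (<⇒≤ lt))
    ne : col w ≢ col x
    ne ce = dif (trans (bitAt-word col p t0 (<⇒≤ lt)) (trans (cong (_≡ᵇ ca) (sym ce)) (sym (bitAt-word col p (suc t0) lt))))
    d = innerShape p t0
    vd : Blob.Valid col tc x d
    vd = record { pos0 = pos0 ; lt0 = lt ; xeq = refl
                ; b0 = subst (λ z → innerBlob (word col p) z t0 0 ≡ false) (sym bx) b0
                ; bL = subst (λ z → innerBlob (word col p) z t0 (len p) ≡ false) (sym bx) bL }
    kk : kindOf (changesOn col p) ≡ k
    kk = trans (cong kindOf rp) (InnerNeed.kd ni)

  option-realised-flip : ∀ col (tc : TwoColoured col) σ' → option flipEnd (abstractPos col) ≡ just σ' → Σ Col λ q → Σ (Move G col q) λ _ → abstractPos q ≡ σ'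
  option-realised-flip col tc σ' e with flip-needs s (changeCount col) (endsDiffer col) σ' e
  ... | r , nzr with count-nonzero n (changesOn col) (suc r) nzr
  ... | p , rp with endStart-exists (len p) (len≤6 p) (word col p) (subst (1 ≤_) (sym rp) (s≤s z≤n))
  ... | t0 , ok with endStart-spec (word col p) (len p) t0 ok
  ... | lt , m , dif = MoveFrom.q col tc x w d vd , (x , w , adj , ne , MoveFrom.onR col tc x w d vd , MoveFrom.offR col tc x w d vd) ,
          just-injective (trans (sym (MoveEffect.effect-flipEnd col tc x w adj ne (MoveFrom.q col tc x w d vd) (MoveFrom.onR col tc x w d vd) (MoveFrom.offR col tc x w d vd) true (not s ∨ Blob.someMonochrome col tc x) vd)) e)
    where
    x = vertexAt p t0
    w = vertexAt p (suc t0)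
    adj = vertexAt-adj p t0 lt
    bx : bit col x ≡ bitAt (word col p) 0
    bx = trans (sym (bitAt-word col p t0 (<⇒≤ lt))) (prefixRun-bit (len p) (len≤6 p) (word col p) (bitAt (word col p) 0) t0 (<⇒≤ lt) m)
    ne : col w ≢ col x
    ne ce = dif (trans (bitAt-word col p t0 (<⇒≤ lt)) (trans (cong (_≡ᵇ ca) (sym ce)) (sym (bitAt-word col p (suc t0) lt))))
    m' : T (prefixRun (word col p) (bit col x) t0)
    m' = subst (λ z → T (prefixRun (word col p) z t0)) (sym bx) m
    d = endShape true (not s ∨ Blob.someMonochrome col tc x)
    xi : T (Blob.flipped col tc x d x)
    xi = flipped-from-u col tc p t0 _ lt m'
    vd : Blob.Valid col tc x d
    vd = Blob.valid-from-uVertex col tc x (Blob.walk-to-u col tc x p t0 (<⇒≤ lt) m' (here refl)) xi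

  option-realised : ∀ col (tc : TwoColoured col) k σ' → option k (abstractPos col) ≡ just σ' → Σ Col λ q → Σ (Move G col q) λ _ → abstractPos q ≡ σ'
  option-realised col tc flipEnd σ' e = option-realised-flip col tc σ' e
  option-realised col tc inner₂ σ' e = option-realised-inner col tc inner₂ σ' e (λ ())
  option-realised col tc inner₄ σ' e = option-realised-inner col tc inner₄ σ' e (λ ())
  option-realised col tc inner₆ σ' e = option-realised-inner col tc inner₆ σ' e (λ ())

  sg-abstract : ∀ fuel col → TwoColoured col → size (abstractPos col) < fuel → SG G col (value (abstractPos col))
  sg-abstract (suc fuel) col tc lt = sg f hf notin mex
    where
    f : ∀ q → Move G col q → ℕ
    f q mv = value (abstractPos q)
    hf : ∀ q mv → SG G q (f q mv)
    hf q mv with move-abstract col tc q mv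
    ... | q-twoColoured , k , e = sg-abstract fuel q q-twoColoured (<-≤-trans (option-size-< k _ _ e) (≤-pred lt))
    notin : ¬ (Σ Col λ q → Σ (Move G col q) λ mv → f q mv ≡ value (abstractPos col))
    notin (q , mv , eq) with move-abstract col tc q mv
    ... | _ , k , e = option-value-≢ k (abstractPos col) (abstractPos q) e eq
    mex : ∀ m → m < value (abstractPos col) → Σ Col λ q → Σ (Move G col q) λ mv → f q mv ≡ m
    mex m lt' with option-value-below (abstractPos col) m lt'
    ... | k , σ' , e , v with option-realised col tc k σ' e
    ... | q , mv , aq = q , mv , trans (cong value aq) v

  sg-abstract-value : ∀ col → TwoColoured col → SG G col (value (abstractPos col))
  sg-abstract-value col tc = sg-abstract (suc (size (abstractPos col))) col tc ≤-refl

  Proper : Col → Set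
  Proper col = ∀ y z → Graph.Adj G y z → col y ≢ col z

  proper-changes : ∀ col → TwoColoured col → Proper col → ∀ p → changesOn col p ≡ len p
  proper-changes col tc pr p = alternating-changes (len p) (len≤6 p) (word col p) d
    where
    d : ∀ t → t < len p → bitAt (word col p) t ≢ bitAt (word col p) (suc t)
    d t lt e = pr (vertexAt p t) (vertexAt p (suc t)) (vertexAt-adj p t lt)
      (bit-injective tc (vertexAt p t) (vertexAt p (suc t)) (trans (sym (bitAt-word col p t (<⇒≤ lt))) (trans e (bitAt-word col p (suc t) lt))))

  proper-changeCount : ∀ col → TwoColoured col → Proper col → ∀ k → changeCount col k ≡ count n len k
  proper-changeCount col tc pr k = count-cong n (changesOn col) len (proper-changes col tc pr) k

  not-swap : ∀ {x y} → x ≡ not y → y ≡ not x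
  not-swap {true} {false} refl = refl
  not-swap {false} {true} refl = refl

  proper-endsDiffer : ∀ col → TwoColoured col → Proper col → (p : Fin n) → endsDiffer col ≡ not (isEven (len p))
  proper-endsDiffer col tc pr p = not-swap (trans (cong isEven (sym (proper-changes col tc pr p))) (changesOn-parity col p))

open AbstractGame
open Multiplicity
open Encoding

occurrences : ℕ → List ℕ → ℕ
occurrences m [] = 0
occurrences m (x ∷ xs) = indicator x m + occurrences m xs

count-lookup : ∀ ls m → count (length ls) (lookup ls) m ≡ occurrences m ls
count-lookup [] m = refl
count-lookup (x ∷ xs) m = cong (indicator x m +_) (count-lookup xs m)

occurrences-replicate-self : ∀ i ys m → occurrences m (replicate i m ++ ys) ≡ i + occurrences m ys
occurrences-replicate-self zero ys m = refl
occurrences-replicate-self (suc i) ys m rewrite indicator-≡ m = cong suc (occurrences-replicate-self i ys m)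

occurrences-replicate-other : ∀ i x ys m → x ≢ m → occurrences m (replicate i x ++ ys) ≡ occurrences m ys
occurrences-replicate-other zero x ys m ne = refl
occurrences-replicate-other (suc i) x ys m ne rewrite indicator-≢ x m ne = occurrences-replicate-other i x ys m ne

occurrences-replicate-self′ : ∀ i m → occurrences m (replicate i m) ≡ i
occurrences-replicate-self′ zero m = refl
occurrences-replicate-self′ (suc i) m rewrite indicator-≡ m = cong suc (occurrences-replicate-self′ i m)

occurrences-replicate-other′ : ∀ i x m → x ≢ m → occurrences m (replicate i x) ≡ 0
occurrences-replicate-other′ zero x m ne = refl
occurrences-replicate-other′ (suc i) x m ne rewrite indicator-≢ x m ne = occurrences-replicate-other′ i x m ne

InRange : ℕ → Set
InRange x = (1 ≤ x) × (x ≤ 6)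

inRange-2 : InRange 2
inRange-2 = s≤s z≤n , s≤s (s≤s z≤n)
inRange-4 : InRange 4
inRange-4 = s≤s z≤n , s≤s (s≤s (s≤s (s≤s z≤n)))
inRange-6 : InRange 6
inRange-6 = s≤s z≤n , ≤-refl
inRange-1 : InRange 1
inRange-1 = s≤s z≤n , s≤s z≤n
inRange-3 : InRange 3
inRange-3 = s≤s z≤n , s≤s (s≤s (s≤s z≤n))
inRange-5 : InRange 5
inRange-5 = s≤s z≤n , s≤s (s≤s (s≤s (s≤s (s≤s z≤n))))

inRange246 : ∀ i j k → All InRange (L246 i j k)
inRange246 i j k = ++⁺ (replicate⁺ i inRange-2) (++⁺ (replicate⁺ j inRange-4) (replicate⁺ k inRange-6))

inRange35 : ∀ i j → All InRange (L35 i j)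
inRange35 i j = ++⁺ (replicate⁺ i inRange-3) (replicate⁺ j inRange-5)

occurrences246 : ∀ i j k → (occurrences 0 (L246 i j k) ≡ 0) × (occurrences 2 (L246 i j k) ≡ i) × (occurrences 4 (L246 i j k) ≡ j) × (occurrences 6 (L246 i j k) ≡ k)
occurrences246 i j k =
  trans (occurrences-replicate-other i 2 _ 0 (λ ())) (trans (occurrences-replicate-other j 4 _ 0 (λ ())) (occurrences-replicate-other′ k 6 0 (λ ()))) ,
  trans (occurrences-replicate-self i _ 2) (trans (cong (i +_) (trans (occurrences-replicate-other j 4 _ 2 (λ ())) (occurrences-replicate-other′ k 6 2 (λ ())))) (+-identityʳ i)) ,
  trans (occurrences-replicate-other i 2 _ 4 (λ ())) (trans (occurrences-replicate-self j _ 4) (trans (cong (j +_) (occurrences-replicate-other′ k 6 4 (λ ()))) (+-identityʳ j))) ,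
  trans (occurrences-replicate-other i 2 _ 6 (λ ())) (trans (occurrences-replicate-other j 4 _ 6 (λ ())) (occurrences-replicate-self′ k 6))

occurrences35 : ∀ i j → (occurrences 0 (L35 i j) ≡ 0) × (occurrences 1 (L35 i j) ≡ 0) × (occurrences 3 (L35 i j) ≡ i) × (occurrences 5 (L35 i j) ≡ j)
occurrences35 i j =
  trans (occurrences-replicate-other i 3 _ 0 (λ ())) (occurrences-replicate-other′ j 5 0 (λ ())) ,
  trans (occurrences-replicate-other i 3 _ 1 (λ ())) (occurrences-replicate-other′ j 5 1 (λ ())) ,
  trans (occurrences-replicate-self i _ 3) (trans (cong (i +_) (occurrences-replicate-other′ j 5 3 (λ ()))) (+-identityʳ i)) ,
  trans (occurrences-replicate-other i 3 _ 5 (λ ())) (occurrences-replicate-self′ j 5)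

value-merged : ∀ c par i j k → c 2 ≡ i → c 4 ≡ j → c 6 ≡ k → value (encode false c par) ≡ value (merged i j k)
value-merged c par i j k refl refl refl = refl

value-sameEnds : ∀ c par i j k → c 0 ≡ 0 → c 2 ≡ i → c 4 ≡ j → c 6 ≡ k → par ≡ false → value (encode true c par) ≡ value (sameEnds i j k)
value-sameEnds c par i j k e0 refl refl refl refl rewrite e0 = refl

value-diffEnds : ∀ c par e i j → c 0 ≡ 0 → c 1 ≡ e → c 3 ≡ i → c 5 ≡ j → par ≡ true → value (encode true c par) ≡ value (diffEnds e i j)
value-diffEnds c par e i j e0 refl refl refl refl rewrite e0 = refl

value-empty : ∀ c par → c 0 ≡ 0 → c 1 ≡ 0 → c 2 ≡ 0 → c 3 ≡ 0 → c 4 ≡ 0 → c 5 ≡ 0 → c 6 ≡ 0 → value (encode true c par) ≡ 0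
value-empty c true e0 e1 e2 e3 e4 e5 e6 rewrite e0 | e1 | e3 | e5 = refl
value-empty c false e0 e1 e2 e3 e4 e5 e6 rewrite e0 | e2 | e4 | e6 = refl

ValueOfCounts : Bool → List ℕ → ℕ → Set
ValueOfCounts s ls target = ∀ (c : ℕ → ℕ) par → (∀ m → c m ≡ occurrences m ls) → (∀ p → par ≡ not (isEven (lookup ls p))) → value (encode s c par) ≡ target

hasValue-of-counts : ∀ s ls (rg : All InRange ls) target → ValueOfCounts s ls target → HasValue (Theta s ls) target
hasValue-of-counts s ls rg target h col (a , b , inAB , pr) =
  subst (SG (Theta s ls) col) (h (changeCount col) (endsDiffer col) (λ m → trans (proper-changeCount col inAB pr m) (count-lookup ls m)) (λ p → proper-endsDiffer col inAB pr p)) (sg-abstract-value col inAB)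
  where open ThetaGame s ls a b (λ p → proj₂ (All.lookup rg (∈-lookup p))) (λ p → proj₁ (All.lookup rg (∈-lookup p)))

merged-value : ∀ i j k target → value (merged i j k) ≡ target → ValueOfCounts false (L246 i j k) target
merged-value i j k target ev c par ec ep with occurrences246 i j k
... | _ , e2 , e4 , e6 = trans (value-merged c par i j k (trans (ec 2) e2) (trans (ec 4) e4) (trans (ec 6) e6)) ev

sameEnds-value : ∀ i j k target → value (sameEnds i j k) ≡ target → (i ≡ 0 → j ≡ 0 → k ≡ 0 → target ≡ 0) → ValueOfCounts true (L246 i j k) target
sameEnds-value i j k target ev emp c par ec ep with occurrences246 i j k
... | e0 , e2 , e4 , e6 = byShape i j k refl refl refl
  where
  byParity : par ≡ false → value (encode true c par) ≡ target
  byParity pf = trans (value-sameEnds c par i j k (trans (ec 0) e0) (trans (ec 2) e2) (trans (ec 4) e4) (trans (ec 6) e6) pf) ev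
  byShape : ∀ i' j' k' → i' ≡ i → j' ≡ j → k' ≡ k → value (encode true c par) ≡ target
  byShape (suc i') j' k' refl refl refl = byParity (ep zero)
  byShape zero (suc j') k' refl refl refl = byParity (ep zero)
  byShape zero zero (suc k') refl refl refl = byParity (ep zero)
  byShape zero zero zero refl refl refl = trans (value-empty c par (ec 0) (ec 1) (ec 2) (ec 3) (ec 4) (ec 5) (ec 6)) (sym (emp refl refl refl))

diffEnds-value : ∀ i j → ValueOfCounts true (L35 i j) (valI i j)
diffEnds-value i j c par ec ep with occurrences35 i j
... | e0 , e1 , e3 , e5 = byShape i j refl refl
  where
  byParity : par ≡ true → value (encode true c par) ≡ valI i j
  byParity pt = value-diffEnds c par 0 i j (trans (ec 0) e0) (trans (ec 1) e1) (trans (ec 3) e3) (trans (ec 5) e5) pt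
  byShape : ∀ i' j' → i' ≡ i → j' ≡ j → value (encode true c par) ≡ valI i j
  byShape (suc i') j' refl refl = byParity (ep zero)
  byShape zero (suc j') refl refl = byParity (ep zero)
  byShape zero zero refl refl = value-empty c par (ec 0) (ec 1) (ec 2) (ec 3) (ec 4) (ec 5) (ec 6)

withEdge-value : ∀ i j → ValueOfCounts true (1 ∷ L35 i j) (valD i)
withEdge-value i j c par ec ep with occurrences35 i j
... | e0 , e1 , e3 , e5 = value-diffEnds c par 1 i j (trans (ec 0) e0) (trans (ec 1) (cong suc e1)) (trans (ec 3) e3) (trans (ec 5) e5) (ep zero)

lemma1 : (∀ i j → HasValue (P0 i j 1) (valA i j))
    × (∀ i j → HasValue (P0 i j 2) (valB i j))
    × (∀ i j k → k ≥ 3 → HasValue (P0 i j k) (valC i j))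
    × (∀ i j → HasValue (P1 i j) (valD i))
    × (∀ i j → HasValue (P246 i j 0) (valE i j))
    × (∀ i j → HasValue (P246 i j 1) (valF i j))
    × (∀ i j → HasValue (P246 i j 2) (valG i j))
    × (∀ i j k → k ≥ 3 → HasValue (P246 i j k) (valH j))
    × (∀ i j → HasValue (P35 i j) (valI i j))
lemma1 =
  (λ i j → hasValue-of-counts false (L246 i j 1) (inRange246 i j 1) _ (merged-value i j 1 _ refl)) ,
  (λ i j → hasValue-of-counts false (L246 i j 2) (inRange246 i j 2) _ (merged-value i j 2 _ refl)) ,
  (λ { i j (suc (suc (suc k))) (s≤s (s≤s (s≤s _))) → hasValue-of-counts false (L246 i j (suc (suc (suc k)))) (inRange246 i j _) _ (merged-value i j _ _ refl) }) ,
  (λ i j → hasValue-of-counts true (1 ∷ L35 i j) (inRange-1 ∷ inRange35 i j) _ (withEdge-value i j)) ,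
  (λ i j → hasValue-of-counts true (L246 i j 0) (inRange246 i j 0) _ (sameEnds-value i j 0 _ refl (λ { refl refl _ → refl }))) ,
  (λ i j → hasValue-of-counts true (L246 i j 1) (inRange246 i j 1) _ (sameEnds-value i j 1 _ refl (λ _ _ ()))) ,
  (λ i j → hasValue-of-counts true (L246 i j 2) (inRange246 i j 2) _ (sameEnds-value i j 2 _ refl (λ _ _ ()))) ,
  (λ { i j (suc (suc (suc k))) (s≤s (s≤s (s≤s _))) → hasValue-of-counts true (L246 i j (suc (suc (suc k)))) (inRange246 i j _) _ (sameEnds-value i j _ _ refl (λ _ _ ())) }) ,
  (λ i j → hasValue-of-counts true (L35 i j) (inRange35 i j) _ (diffEnds-value i j))
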